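{- For every odd positive integer $k$, there exists a tight polyhedron of type $\{3k,4\}$ which is regular but not orientably-regular, and whose automorphism group is isomorphic to $$\Lambda(k)=\langle \rho_0,\rho_1,\rho_2 \mid \rho_0^2,\ \rho_1^2,\ \rho_2^2,\ (\rho_0\rho_1)^{3k},\ (\rho_0\rho_2)^2,\ (\rho_1\rho_2)^4,\ \rho_0\rho_1\rho_2\rho_1\rho_0\rho_1\rho_2\rho_1\rho_2\rangle.$$
   Context: A polyhedron is an abstract polytope of rank $3$ (a ranked poset with ranks $-1$ to $3$, unique least and greatest faces, flags of $5$ faces, connected sections, and the diamond condition). It has type $\{p,q\}$ if every $2$-face is a $p$-gon and every vertex-figure a $q$-gon; it is tight if it has exactly $2pq$ flags. It is regular if its automorphism group acts transitively on flags, in which case the group is generated by the reflections $\rho_0,\rho_1,\rho_2$ with respect to a base flag; a regular polyhedron is orientably-regular if the rotation subgroup $\langle\rho_0\rho_1,\rho_1\rho_2\rangle$ has index $2$ in the automorphism group, and non-orientably-regular if this subgroup is the whole automorphism group. -}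

module Defs where

open import Data.Nat using (ℕ; zero; suc; _+_; _*_; _≤_; _<_)
open import Data.Fin using (Fin; toℕ) renaming (zero to f0; suc to fs)
open import Data.Fin.Patterns using (0F; 1F; 2F; 3F; 4F)
open import Data.Bool using (Bool; true; false; T; not)
open import Data.Vec using (Vec; lookup; _[_]≔_)
open import Data.List using (List; []; _∷_; _++_; concat; replicate)
open import Data.List.Membership.Propositional using (_∈_)
open import Data.Product using (Σ; ∃; _×_; _,_; proj₁)
open import Data.Sum using (_⊎_)
open import Relation.Nullary using (¬_)
open import Relation.Binary.PropositionalEquality using (_≡_; _≢_)
open import Relation.Binary.Construct.Closure.ReflexiveTransitive using (Star)
open import Function using (_∘_; id)
open import Function.Bundles using (_↔_)

-- The partial order is given by a Bool-valued
-- incidence function (so that it is decidable and proof-irrelevant).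
-- The rank is stored shifted by one: rank value r : Fin 5 stands for
-- the rank r - 1 ∈ {-1,0,1,2,3}.

record Polyhedron : Set₁ where
  field
    n     : ℕ
    le    : Fin n → Fin n → Bool
    rank  : Fin n → Fin 5

  _≼_ : Fin n → Fin n → Set
  F ≼ G = T (le F G)

  _≺_ : Fin n → Fin n → Set
  F ≺ G = F ≼ G × F ≢ G

  field
    ≼-refl    : ∀ F → F ≼ F
    ≼-antisym : ∀ F G → F ≼ G → G ≼ F → F ≡ G
    ≼-trans   : ∀ F G H → F ≼ G → G ≼ H → F ≼ H
    least     : Fin n
    least-min : ∀ F → least ≼ F
    greatest  : Fin n
    greatest-max : ∀ F → F ≼ greatest
    -- ranked: the rank function is strictly monotone and there are no
    -- gaps, so that every flag (maximal chain) contains exactly one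
    -- face of each rank -1,0,1,2,3 (5 faces in total)
    least-rank    : toℕ (rank least) ≡ 0
    greatest-rank : toℕ (rank greatest) ≡ 4
    rank-strict   : ∀ F G → F ≺ G → toℕ (rank F) < toℕ (rank G)
    no-gaps       : ∀ F G → F ≼ G → suc (suc (toℕ (rank F))) ≤ toℕ (rank G) →
                    Σ (Fin n) λ H → F ≼ H × H ≼ G × toℕ (rank H) ≡ suc (toℕ (rank F))
    diamond : ∀ F G → F ≼ G → toℕ (rank G) ≡ suc (suc (toℕ (rank F))) →
              Σ (Fin n) λ H₁ → Σ (Fin n) λ H₂ → H₁ ≢ H₂ ×
                (F ≼ H₁ × H₁ ≼ G × toℕ (rank H₁) ≡ suc (toℕ (rank F))) ×
                (F ≼ H₂ × H₂ ≼ G × toℕ (rank H₂) ≡ suc (toℕ (rank F))) ×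
                (∀ H → F ≼ H → H ≼ G → toℕ (rank H) ≡ suc (toℕ (rank F)) →
                   H ≡ H₁ ⊎ H ≡ H₂)
    connected : ∀ F G → F ≼ G → 3 + toℕ (rank F) ≤ toℕ (rank G) →
                ∀ H H' → F ≺ H → H ≺ G → F ≺ H' → H' ≺ G →
                Star (λ X Y → (F ≺ X × X ≺ G) × (F ≺ Y × Y ≺ G) × (X ≼ Y ⊎ Y ≼ X)) H H'

  IsFlag : Vec (Fin n) 5 → Set
  -- (written with explicit finite conjunctions so that IsFlag is a
  -- proposition without function extensionality; the chain condition
  -- for non-consecutive faces follows by transitivity)
  IsFlag Φ = rank (lookup Φ 0F) ≡ 0F × rank (lookup Φ 1F) ≡ 1F ×
             rank (lookup Φ 2F) ≡ 2F × rank (lookup Φ 3F) ≡ 3F ×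
             rank (lookup Φ 4F) ≡ 4F ×
             lookup Φ 0F ≼ lookup Φ 1F × lookup Φ 1F ≼ lookup Φ 2F ×
             lookup Φ 2F ≼ lookup Φ 3F × lookup Φ 3F ≼ lookup Φ 4F

  Flag : Set
  Flag = Σ (Vec (Fin n) 5) IsFlag

  -- index in the flag vector of the face of (true) rank i ∈ {0,1,2}
  pos : Fin 3 → Fin 5
  pos 0F = 1F
  pos 1F = 2F
  pos 2F = 3F

  Adjacent : Fin 3 → Vec (Fin n) 5 → Vec (Fin n) 5 → Set
  Adjacent i Φ Ψ = IsFlag Φ × IsFlag Ψ × lookup Φ (pos i) ≢ lookup Ψ (pos i) ×
                   Ψ ≡ (Φ [ pos i ]≔ lookup Ψ (pos i))

  record Aut : Set where
    field
      fwd  : Fin n → Fin n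
      bwd  : Fin n → Fin n
      fwd-bwd : ∀ x → fwd (bwd x) ≡ x
      bwd-fwd : ∀ x → bwd (fwd x) ≡ x
      pres : ∀ F G → F ≼ G → fwd F ≼ fwd G
      refl' : ∀ F G → fwd F ≼ fwd G → F ≼ G

  open Aut public

  _≈ᴬ_ : (Fin n → Fin n) → (Fin n → Fin n) → Set
  f ≈ᴬ g = ∀ x → f x ≡ g x

  actFlag : Aut → Vec (Fin n) 5 → Vec (Fin n) 5
  actFlag α = Data.Vec.map (fwd α)

module _ (P : Polyhedron) where
  open Polyhedron P

  HasExactly : ℕ → (Fin n → Set) → Set
  HasExactly m S = Σ (Fin n) S ↔ Fin m

  HasType : ℕ → ℕ → Set
  HasType p q =
    (∀ F → toℕ (rank F) ≡ 3 →
       HasExactly p (λ v → toℕ (rank v) ≡ 1 × v ≼ F)) ×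
    (∀ v → toℕ (rank v) ≡ 1 →
       HasExactly q (λ e → toℕ (rank e) ≡ 2 × v ≼ e))

  Tight : ℕ → ℕ → Set
  Tight p q = Flag ↔ Fin (2 * p * q)

  Regular : Set
  Regular = ∀ (Φ Ψ : Flag) → Σ Aut λ α → actFlag α (proj₁ Φ) ≡ proj₁ Ψ

-- Words in the free group on generators Fin m (letter (i , true) is the
-- generator, (i , false) its inverse), evaluated in Aut P.

Letter : ℕ → Set
Letter m = Fin m × Bool

Word : ℕ → Set
Word m = List (Letter m)

module _ (P : Polyhedron) where
  open Polyhedron P

  eval : ∀ {m} → (Fin m → Aut) → Word m → Fin n → Fin n
  eval a [] = id
  eval a ((i , true) ∷ w) = fwd (a i) ∘ eval a w
  eval a ((i , false) ∷ w) = bwd (a i) ∘ eval a w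

  compAut : Aut → Aut → Aut
  compAut α β = record
    { fwd = fwd α ∘ fwd β
    ; bwd = bwd β ∘ bwd α
    ; fwd-bwd = λ x → Relation.Binary.PropositionalEquality.trans
                        (Relation.Binary.PropositionalEquality.cong (fwd α) (fwd-bwd β (bwd α x)))
                        (fwd-bwd α x)
    ; bwd-fwd = λ x → Relation.Binary.PropositionalEquality.trans
                        (Relation.Binary.PropositionalEquality.cong (bwd β) (bwd-fwd α (fwd β x)))
                        (bwd-fwd β x)
    ; pres = λ F G p → pres α _ _ (pres β F G p)
    ; refl' = λ F G p → refl' β F G (refl' α _ _ p)
    }

  -- Non-orientably-regular: for a base flag Φ with distinguished
  -- generators ρ₀,ρ₁,ρ₂ (ρᵢ maps Φ to its i-adjacent flag), the
  -- rotation subgroup ⟨ρ₀ρ₁, ρ₁ρ₂⟩ is the whole automorphism group.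
  NonOrientablyRegular : Set
  NonOrientablyRegular =
    Regular P ×
    Σ Flag λ Φ → Σ (Fin 3 → Aut) λ ρ →
      (∀ i → Adjacent i (proj₁ Φ) (actFlag (ρ i) (proj₁ Φ))) ×
      (∀ (α : Aut) → Σ (Word 2) λ w →
         eval (λ { 0F → compAut (ρ 0F) (ρ 1F) ; 1F → compAut (ρ 1F) (ρ 2F) }) w ≈ᴬ fwd α)

data _~[_]_ {m : ℕ} : Word m → List (Word m) → Word m → Set where
  ~refl  : ∀ {R u} → u ~[ R ] u
  ~sym   : ∀ {R u v} → u ~[ R ] v → v ~[ R ] u
  ~trans : ∀ {R u v w} → u ~[ R ] v → v ~[ R ] w → u ~[ R ] w
  ~cong  : ∀ {R u u' v v'} → u ~[ R ] u' → v ~[ R ] v' → (u ++ v) ~[ R ] (u' ++ v')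
  ~cancel : ∀ {R} i b → ((i , b) ∷ (i , not b) ∷ []) ~[ R ] []
  ~rel   : ∀ {R r} → r ∈ R → r ~[ R ] []

AutIsoPresentation : Polyhedron → (m : ℕ) → List (Word m) → Set
AutIsoPresentation P m R =
  Σ (Fin m → Polyhedron.Aut P) λ a →
    (∀ u v → u ~[ R ] v → Polyhedron._≈ᴬ_ P (eval P a u) (eval P a v)) ×
    (∀ u v → Polyhedron._≈ᴬ_ P (eval P a u) (eval P a v) → u ~[ R ] v) ×
    (∀ (α : Polyhedron.Aut P) → Σ (Word m) λ w →
       Polyhedron._≈ᴬ_ P (eval P a w) (Polyhedron.Aut.fwd α))

g : Fin 3 → Letter 3
g i = (i , true)

ΛRelators : ℕ → List (Word 3)
ΛRelators k =
  (g 0F ∷ g 0F ∷ []) ∷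
  (g 1F ∷ g 1F ∷ []) ∷
  (g 2F ∷ g 2F ∷ []) ∷
  concat (replicate (3 * k) (g 0F ∷ g 1F ∷ [])) ∷
  concat (replicate 2 (g 0F ∷ g 2F ∷ [])) ∷
  concat (replicate 4 (g 1F ∷ g 2F ∷ [])) ∷
  (g 0F ∷ g 1F ∷ g 2F ∷ g 1F ∷ g 0F ∷ g 1F ∷ g 2F ∷ g 1F ∷ g 2F ∷ []) ∷
  []

module Submission where

-- The polyhedron is a 3k-gon with doubled edges, closed up by four 2-faces. Its vertices form
-- ℤ/3k, consecutive vertices i and i + 1 are joined by two edges, and the 2-faces are the vectors
-- of 𝔽₂²: the edges from i lie on the faces where the nonzero linear form number i mod 3 takes
-- a prescribed value. So every 2-face is a 3k-gon, every vertex has four edges and there are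
-- 2 · 3k · 4 flags. The reflections ρ₀, ρ₁ of the 3k-gon and the map ρ₂ swapping every pair of
-- edges are automorphisms satisfying the relators of Λ(k).
--
-- Modulo the relators every word equals one of the 24k normal forms (ρ₀ρ₁)^a ρ₀^s t_v, where the
-- t_v form the subgroup fixing all vertices; distinct normal forms already act differently on the
-- vertices 0, 1 and one 2-face, so the presentation is faithful. By the diamond condition and
-- connectivity an automorphism is determined by the image of one flag, and explicit words reach
-- every flag; hence Λ(k) ≅ Aut P acts regularly on the flags. Finally the relators give
-- ρ₂ = (ρ₁ρ₂)(ρ₀ρ₁)⁻¹(ρ₁ρ₂)(ρ₀ρ₁)⁻¹, so the rotation subgroup is the whole group.

open import Defs
open import Data.Nat using (ℕ; zero; suc; _+_; _*_; _≤_; _<_; z≤n; s≤s; _<ᵇ_)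
open import Data.Nat.Properties
  using (≡-irrelevant; n≤1+n; 1+n≰n; *-suc; *-comm; +-comm; ≤-trans; <ᵇ⇒<; <⇒≱)
open import Data.Nat.Divisibility using (_∣_; _∣0)
open import Data.Nat.GeneralisedArithmetic using (fold; fold-+)
open import Data.Fin using (Fin; toℕ; fromℕ; inject₁; opposite; zero; suc)
open import Data.Fin.Patterns using (0F; 1F; 2F; 3F; 4F)
open import Data.Fin.Properties
  using (≤-antisym; toℕ-injective; toℕ-fromℕ; toℕ-inject₁; opposite-involutive; toℕ≤pred[n];
         +↔⊎; *↔×; 1↔⊤; 2↔Bool)
open import Data.Fin.Relation.Unary.Top using (View; view; ‵fromℕ; ‵inj₁; view-fromℕ; view-inject₁)
open import Data.Bool using (Bool; true; false; T; _xor_)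
open import Data.Bool.Properties using (xor-assoc; xor-same; xor-identityʳ; not-involutive; T-irrelevant)
open import Data.Unit using (⊤; tt)
open import Data.Empty using (⊥-elim)
open import Data.Product using (Σ; _×_; _,_; proj₁; proj₂)
open import Data.Product.Properties using (≡-dec)
open import Data.Product.Algebra using (×-comm; ×-assoc)
open import Data.Product.Function.NonDependent.Propositional using (_×-↔_)
open import Data.Sum using (_⊎_; inj₁; inj₂)
open import Data.Sum.Function.Propositional using (_⊎-↔_)
open import Data.Vec using (Vec; []; _∷_; lookup)
import Data.Vec as Vec
open import Data.List using ([]; _∷_; _++_; concat; replicate)
open import Data.List.Properties using (++-assoc; ++-identityʳ)
open import Data.List.Membership.Propositional using (_∈_)
open import Data.List.Relation.Unary.Any using (here; there)
open import Function using (_∘_; id)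
open import Function.Bundles using (_↔_; Inverse; mk↔ₛ′)
open import Function.Properties.Inverse using (↔-sym; ↔-trans)
open import Relation.Nullary using (¬_; Dec; yes; no)
open import Relation.Nullary.Decidable using (map′; _⊎-dec_; isYes; toWitness; fromWitness)
open import Level using (0ℓ)
open import Relation.Binary.Bundles using (Setoid)
open import Relation.Binary.PropositionalEquality
import Relation.Binary.Reasoning.Setoid as SetoidReasoning
open import Relation.Binary.Construct.Closure.ReflexiveTransitive using (Star; ε; _◅_; _◅◅_; gmap)
import Relation.Binary.Construct.Closure.ReflexiveTransitive as Star
open import Axiom.UniquenessOfIdentityProofs using (module Decidable⇒UIP)

<ᵇ-sound : ∀ {m n} {_ : T (m <ᵇ n)} → m < n
<ᵇ-sound {m} {n} {t} = <ᵇ⇒< m n t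

<ᵇ-refutes-≤ : ∀ {m n} → T (n <ᵇ m) → ¬ m ≤ n
<ᵇ-refutes-≤ {m} {n} t = <⇒≱ (<ᵇ⇒< n m t)

infixr 5 _∷≡_
_∷≡_ : ∀ {A : Set} {m} {x y : A} {xs ys : Vec A m} → x ≡ y → xs ≡ ys → x ∷ xs ≡ y ∷ ys
_∷≡_ = cong₂ _∷_

-- fold x f m is the iterate fᵐ x.
fold-comm : ∀ {A : Set} (f g : A → A) → (∀ x → f (g x) ≡ g (f x)) →
            ∀ x m → f (fold x g m) ≡ fold (f x) g m
fold-comm f g fg x zero = refl
fold-comm f g fg x (suc m) = trans (fg _) (cong g (fold-comm f g fg x m))

fold-periodic : ∀ {A : Set} (f : A → A) p → (∀ x → fold x f p ≡ x) → ∀ x t → fold x f (t * p) ≡ x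
fold-periodic f p per x zero = refl
fold-periodic f p per x (suc t) = trans (fold-+ x f p) (trans (per _) (fold-periodic f p per x t))

opposite-inject₁ : ∀ {n} (i : Fin n) → opposite (inject₁ i) ≡ suc (opposite i)
opposite-inject₁ {suc n} zero = refl
opposite-inject₁ {suc n} (suc i) = cong inject₁ (opposite-inject₁ i)

module Cyclic {n : ℕ} where

  csuc : Fin (suc n) → Fin (suc n)
  csuc i = next (view i)
    where
    next : ∀ {i : Fin (suc n)} → View i → Fin (suc n)
    next ‵fromℕ = zero
    next (‵inj₁ {i = j} _) = suc j

  cpred : Fin (suc n) → Fin (suc n)
  cpred zero = fromℕ n
  cpred (suc i) = inject₁ i

  csuc-fromℕ : csuc (fromℕ n) ≡ zero
  csuc-fromℕ rewrite view-fromℕ n = refl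

  csuc-inject₁ : ∀ (i : Fin n) → csuc (inject₁ i) ≡ suc i
  csuc-inject₁ i rewrite view-inject₁ i = refl

  csuc-cpred : ∀ i → csuc (cpred i) ≡ i
  csuc-cpred zero = csuc-fromℕ
  csuc-cpred (suc i) = csuc-inject₁ i

  cpred-csuc : ∀ i → cpred (csuc i) ≡ i
  cpred-csuc i with view i
  ... | ‵fromℕ = refl
  ... | ‵inj₁ _ = refl

  opposite-csuc : ∀ i → opposite (csuc i) ≡ cpred (opposite i)
  opposite-csuc i with view i
  ... | ‵fromℕ = cong cpred (sym (opposite-involutive zero))
  ... | ‵inj₁ {i = j} _ = sym (cong cpred (opposite-inject₁ j))

  toℕ-csuc : ∀ i → toℕ (csuc i) ≡ suc (toℕ i) ⊎ (csuc i ≡ zero × toℕ i ≡ n)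
  toℕ-csuc i with view i
  ... | ‵fromℕ = inj₂ (refl , toℕ-fromℕ n)
  ... | ‵inj₁ {i = j} _ = inj₁ (cong suc (sym (toℕ-inject₁ j)))

  fold-csuc-toℕ : ∀ i → fold zero csuc (toℕ i) ≡ i
  fold-csuc-toℕ i = toℕ-injective (toℕ-fold (toℕ i) (toℕ≤pred[n] i))
    where
    toℕ-fold : ∀ m → m ≤ n → toℕ (fold zero csuc m) ≡ m
    toℕ-fold zero _ = refl
    toℕ-fold (suc m) m<n with toℕ-csuc (fold zero csuc m) | toℕ-fold m (≤-trans (n≤1+n m) m<n)
    ... | inj₁ e | ih = trans e (cong suc ih)
    ... | inj₂ (_ , e) | ih = ⊥-elim (1+n≰n (subst (λ t → suc t ≤ n) (trans (sym ih) e) m<n))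

  fold-csuc-period : ∀ i → fold i csuc (suc n) ≡ i
  fold-csuc-period i = begin
    fold i csuc (suc n)                         ≡⟨ cong (λ j → fold j csuc (suc n)) (sym (fold-csuc-toℕ i)) ⟩
    fold (fold zero csuc (toℕ i)) csuc (suc n)  ≡⟨ sym (fold-+ zero csuc (suc n)) ⟩
    fold zero csuc (suc n + toℕ i)              ≡⟨ cong (fold zero csuc) (+-comm (suc n) (toℕ i)) ⟩
    fold zero csuc (toℕ i + suc n)              ≡⟨ fold-+ zero csuc (toℕ i) ⟩
    fold (fold zero csuc (suc n)) csuc (toℕ i)  ≡⟨ cong (λ j → fold j csuc (toℕ i)) full-turn ⟩
    fold zero csuc (toℕ i)                      ≡⟨ fold-csuc-toℕ i ⟩
    i                                           ∎
    where
    open ≡-Reasoning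
    full-turn : fold zero csuc (suc n) ≡ zero
    full-turn = trans (cong csuc (trans (cong (fold zero csuc) (sym (toℕ-fromℕ n))) (fold-csuc-toℕ (fromℕ n))))
                      csuc-fromℕ


module Construction (n : ℕ) where

  open Cyclic {n}

  k : ℕ
  k = suc n

  -- The vertex (q , m) stands for 3q + m ∈ ℤ/3k; its position m = 3q + m mod 3
  -- decides in which 2-faces the edges starting at it lie.
  Vertex : Set
  Vertex = Fin k × Fin 3

  pos : Vertex → Fin 3
  pos = proj₂

  origin : Vertex
  origin = (zero , 0F)

  index : Vertex → ℕ
  index (q , m) = toℕ m + 3 * toℕ q

  _≟ᵥ_ : (i j : Vertex) → Dec (i ≡ j)
  _≟ᵥ_ = ≡-dec Data.Fin._≟_ Data.Fin._≟_

  vsuc vpred : Vertex → Vertex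
  vsuc (q , 0F) = (q , 1F)
  vsuc (q , 1F) = (q , 2F)
  vsuc (q , 2F) = (csuc q , 0F)
  vpred (q , 0F) = (cpred q , 2F)
  vpred (q , 1F) = (q , 0F)
  vpred (q , 2F) = (q , 1F)

  -- j ↦ −1 − j, j ↦ −j and j ↦ 1 − j
  vopp vneg₀ vneg₁ : Vertex → Vertex
  vopp (q , 0F) = (opposite q , 2F)
  vopp (q , 1F) = (opposite q , 1F)
  vopp (q , 2F) = (opposite q , 0F)
  vneg₀ j = vsuc (vopp j)
  vneg₁ j = vsuc (vneg₀ j)

  vsuc-vpred : ∀ j → vsuc (vpred j) ≡ j
  vsuc-vpred (q , 0F) = cong (_, 0F) (csuc-cpred q)
  vsuc-vpred (q , 1F) = refl
  vsuc-vpred (q , 2F) = refl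

  vpred-vsuc : ∀ j → vpred (vsuc j) ≡ j
  vpred-vsuc (q , 0F) = refl
  vpred-vsuc (q , 1F) = refl
  vpred-vsuc (q , 2F) = cong (_, 2F) (cpred-csuc q)

  vsuc≢ : ∀ j → vsuc j ≢ j
  vsuc≢ (q , 0F) ()
  vsuc≢ (q , 1F) ()
  vsuc≢ (q , 2F) ()

  vsuc²≢ : ∀ j → vsuc (vsuc j) ≢ j
  vsuc²≢ (q , 0F) ()
  vsuc²≢ (q , 1F) ()
  vsuc²≢ (q , 2F) ()

  vpred≢ : ∀ j → vpred j ≢ j
  vpred≢ (q , 0F) ()
  vpred≢ (q , 1F) ()
  vpred≢ (q , 2F) ()

  vopp-involutive : ∀ j → vopp (vopp j) ≡ j
  vopp-involutive (q , 0F) = cong (_, 0F) (opposite-involutive q)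
  vopp-involutive (q , 1F) = cong (_, 1F) (opposite-involutive q)
  vopp-involutive (q , 2F) = cong (_, 2F) (opposite-involutive q)

  vopp-vsuc : ∀ j → vopp (vsuc j) ≡ vpred (vopp j)
  vopp-vsuc (q , 0F) = refl
  vopp-vsuc (q , 1F) = refl
  vopp-vsuc (q , 2F) = cong (_, 2F) (opposite-csuc q)

  vneg₀-vsuc : ∀ j → vneg₀ (vsuc j) ≡ vopp j
  vneg₀-vsuc j = trans (cong vsuc (vopp-vsuc j)) (vsuc-vpred (vopp j))

  vneg₁-vsuc : ∀ j → vneg₁ (vsuc j) ≡ vneg₀ j
  vneg₁-vsuc j = cong vsuc (vneg₀-vsuc j)

  vneg₀-involutive : ∀ j → vneg₀ (vneg₀ j) ≡ j
  vneg₀-involutive j = trans (vneg₀-vsuc (vopp j)) (vopp-involutive j)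

  vneg₁-involutive : ∀ j → vneg₁ (vneg₁ j) ≡ j
  vneg₁-involutive j = trans (cong vsuc (vneg₀-vsuc (vneg₀ j))) (vneg₀-involutive j)

  vneg₁-vneg₀ : ∀ j → vneg₁ (vneg₀ j) ≡ vsuc j
  vneg₁-vneg₀ j = cong vsuc (vneg₀-involutive j)

  vneg₀-vopp : ∀ j → vneg₀ (vopp j) ≡ vsuc j
  vneg₀-vopp j = cong vsuc (vopp-involutive j)

  vneg₀-origin : vneg₀ origin ≡ origin
  vneg₀-origin = cong (_, 0F) csuc-fromℕ

  fold-vsuc-3 : ∀ q m → fold (q , m) vsuc 3 ≡ (csuc q , m)
  fold-vsuc-3 q 0F = refl
  fold-vsuc-3 q 1F = refl
  fold-vsuc-3 q 2F = refl

  fold-vsuc-3* : ∀ t q m → fold (q , m) vsuc (3 * t) ≡ (fold q csuc t , m)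
  fold-vsuc-3* zero q m = refl
  fold-vsuc-3* (suc t) q m = begin
    fold (q , m) vsuc (3 * suc t)        ≡⟨ cong (fold (q , m) vsuc) (*-suc 3 t) ⟩
    fold (q , m) vsuc (3 + 3 * t)        ≡⟨ fold-+ (q , m) vsuc 3 {3 * t} ⟩
    fold (fold (q , m) vsuc (3 * t)) vsuc 3  ≡⟨ cong (λ j → fold j vsuc 3) (fold-vsuc-3* t q m) ⟩
    fold (fold q csuc t , m) vsuc 3      ≡⟨ fold-vsuc-3 _ m ⟩
    (fold q csuc (suc t) , m)            ∎
    where open ≡-Reasoning

  fold-vsuc-index : ∀ j → fold origin vsuc (index j) ≡ j
  fold-vsuc-index (q , m) = begin
    fold origin vsuc (toℕ m + 3 * toℕ q)
      ≡⟨ fold-+ origin vsuc (toℕ m) ⟩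
    fold (fold origin vsuc (3 * toℕ q)) vsuc (toℕ m)
      ≡⟨ cong (λ j → fold j vsuc (toℕ m)) (fold-vsuc-3* (toℕ q) zero 0F) ⟩
    fold (fold zero csuc (toℕ q) , 0F) vsuc (toℕ m)
      ≡⟨ cong (λ i → fold (i , 0F) vsuc (toℕ m)) (fold-csuc-toℕ q) ⟩
    fold (q , 0F) vsuc (toℕ m)
      ≡⟨ walk m ⟩
    (q , m) ∎
    where
    open ≡-Reasoning
    walk : ∀ m → fold (q , 0F) vsuc (toℕ m) ≡ (q , m)
    walk 0F = refl
    walk 1F = refl
    walk 2F = refl

  fold-vsuc-index-from-1 : ∀ j → fold (vsuc origin) vsuc (index j) ≡ vsuc j
  fold-vsuc-index-from-1 j =
    trans (sym (fold-comm vsuc vsuc (λ _ → refl) origin (index j))) (cong vsuc (fold-vsuc-index j))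

  fold-vsuc-period : ∀ j → fold j vsuc (3 * k) ≡ j
  fold-vsuc-period (q , m) = trans (fold-vsuc-3* k q m) (cong (_, m) (fold-csuc-period q))

  index-vsuc : ∀ j → index (vsuc j) ≡ suc (index j) ⊎ (vsuc j ≡ origin × suc (index j) ≡ 3 * k)
  index-vsuc (q , 0F) = inj₁ refl
  index-vsuc (q , 1F) = inj₁ refl
  index-vsuc (q , 2F) with toℕ-csuc q
  ... | inj₁ e = inj₁ (trans (cong (3 *_) e) (*-suc 3 (toℕ q)))
  ... | inj₂ (e , eq) = inj₂ (cong (_, 0F) e , trans (cong (λ t → 3 + 3 * t) eq) (sym (*-suc 3 n)))

  -- The 2-faces are the vectors of 𝔽₂², and label 0, label 1, label 2 are its nonzero linear forms.
  Label : Set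
  Label = Bool × Bool

  _≟ₗ_ : (f f' : Label) → Dec (f ≡ f')
  _≟ₗ_ = ≡-dec Data.Bool._≟_ Data.Bool._≟_

  _⊕_ : Label → Label → Label
  (x , y) ⊕ (x' , y') = (x xor x' , y xor y')

  base : Label
  base = (false , false)

  label : Fin 3 → Label → Bool
  label 0F (x , y) = y
  label 1F (x , y) = x
  label 2F (x , y) = x xor y

  ker : Fin 3 → Label
  ker 0F = (true , false)
  ker 1F = (false , true)
  ker 2F = (true , true)

  labelled : Fin 3 → Bool → Label
  labelled 0F b = (false , b)
  labelled 1F b = (b , false)
  labelled 2F b = (b , false)

  label-base : ∀ m → label m base ≡ false
  label-base 0F = refl
  label-base 1F = refl
  label-base 2F = refl

  label-ker : ∀ m → label m (ker m) ≡ false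
  label-ker 0F = refl
  label-ker 1F = refl
  label-ker 2F = refl

  label-labelled : ∀ m b → label m (labelled m b) ≡ b
  label-labelled 0F b = refl
  label-labelled 1F b = refl
  label-labelled 2F false = refl
  label-labelled 2F true = refl

  label-⊕ker : ∀ m f → label m (f ⊕ ker m) ≡ label m f
  label-⊕ker 0F (x , y) = xor-identityʳ y
  label-⊕ker 1F (x , y) = xor-identityʳ x
  label-⊕ker 2F (false , false) = refl
  label-⊕ker 2F (false , true) = refl
  label-⊕ker 2F (true , false) = refl
  label-⊕ker 2F (true , true) = refl

  f≢f⊕ker : ∀ m f → f ≢ f ⊕ ker m
  f≢f⊕ker 0F (false , y) ()
  f≢f⊕ker 0F (true , y) ()
  f≢f⊕ker 1F (x , false) ()
  f≢f⊕ker 1F (x , true) ()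
  f≢f⊕ker 2F (false , y) ()
  f≢f⊕ker 2F (true , y) ()

  label-fibre : ∀ m f → f ≡ labelled m (label m f) ⊎ f ≡ labelled m (label m f) ⊕ ker m
  label-fibre 0F (false , false) = inj₁ refl
  label-fibre 0F (false , true) = inj₁ refl
  label-fibre 0F (true , false) = inj₂ refl
  label-fibre 0F (true , true) = inj₂ refl
  label-fibre 1F (false , false) = inj₁ refl
  label-fibre 1F (false , true) = inj₂ refl
  label-fibre 1F (true , false) = inj₁ refl
  label-fibre 1F (true , true) = inj₂ refl
  label-fibre 2F (false , false) = inj₁ refl
  label-fibre 2F (false , true) = inj₂ refl
  label-fibre 2F (true , false) = inj₁ refl
  label-fibre 2F (true , true) = inj₂ refl

  -- edge i false and edge i true are the two edges joining i and i + 1.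
  data Face : Set where
    bot top : Face
    vert : Vertex → Face
    edge : Vertex → Bool → Face
    poly : Label → Face

  rank : Face → Fin 5
  rank bot = 0F
  rank (vert _) = 1F
  rank (edge _ _) = 2F
  rank (poly _) = 3F
  rank top = 4F

  infix 4 _⊑_ _⊏_
  data _⊑_ : Face → Face → Set where
    ⊑-refl    : ∀ {x} → x ⊑ x
    bot⊑      : ∀ {x} → bot ⊑ x
    ⊑top      : ∀ {x} → x ⊑ top
    vert⊑edge : ∀ {j i β} → j ≡ i ⊎ j ≡ vsuc i → vert j ⊑ edge i β
    edge⊑poly : ∀ {i β f} → label (pos i) f ≡ β → edge i β ⊑ poly f
    vert⊑poly : ∀ {j f} → vert j ⊑ poly f

  _⊏_ : Face → Face → Set
  x ⊏ y = x ⊑ y × x ≢ y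

  _⊑?_ : ∀ x y → Dec (x ⊑ y)
  bot ⊑? y = yes bot⊑
  x ⊑? top = yes ⊑top
  vert j ⊑? vert j' = map′ (λ { refl → ⊑-refl }) (λ { ⊑-refl → refl }) (j ≟ᵥ j')
  vert j ⊑? edge i β = map′ vert⊑edge (λ { (vert⊑edge e) → e }) ((j ≟ᵥ i) ⊎-dec (j ≟ᵥ vsuc i))
  vert j ⊑? poly f = yes vert⊑poly
  edge i β ⊑? edge i' β' =
    map′ (λ { refl → ⊑-refl }) (λ { ⊑-refl → refl }) (≡-dec _≟ᵥ_ Data.Bool._≟_ (i , β) (i' , β'))
  edge i β ⊑? poly f = map′ edge⊑poly (λ { (edge⊑poly e) → e }) (label (pos i) f Data.Bool.≟ β)
  poly f ⊑? poly f' = map′ (λ { refl → ⊑-refl }) (λ { ⊑-refl → refl }) (f ≟ₗ f')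
  vert _ ⊑? bot = no λ ()
  edge _ _ ⊑? bot = no λ ()
  edge _ _ ⊑? vert _ = no λ ()
  poly _ ⊑? bot = no λ ()
  poly _ ⊑? vert _ = no λ ()
  poly _ ⊑? edge _ _ = no λ ()
  top ⊑? bot = no λ ()
  top ⊑? vert _ = no λ ()
  top ⊑? edge _ _ = no λ ()
  top ⊑? poly _ = no λ ()

  ⊑-trans : ∀ {x y z} → x ⊑ y → y ⊑ z → x ⊑ z
  ⊑-trans ⊑-refl q = q
  ⊑-trans p ⊑-refl = p
  ⊑-trans bot⊑ q = bot⊑
  ⊑-trans p ⊑top = ⊑top
  ⊑-trans (vert⊑edge _) (edge⊑poly _) = vert⊑poly

  ⊑-antisym : ∀ {x y} → x ⊑ y → y ⊑ x → x ≡ y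
  ⊑-antisym ⊑-refl _ = refl
  ⊑-antisym bot⊑ bot⊑ = refl
  ⊑-antisym bot⊑ ⊑-refl = refl
  ⊑-antisym ⊑top ⊑top = refl
  ⊑-antisym ⊑top ⊑-refl = refl

  ⊑-rank< : ∀ {x y} → x ⊑ y → x ≢ y → toℕ (rank x) < toℕ (rank y)
  ⊑-rank< ⊑-refl x≢y = ⊥-elim (x≢y refl)
  ⊑-rank< (bot⊑ {bot}) x≢y = ⊥-elim (x≢y refl)
  ⊑-rank< (⊑top {top}) x≢y = ⊥-elim (x≢y refl)
  ⊑-rank< (bot⊑ {top}) _ = <ᵇ-sound
  ⊑-rank< (bot⊑ {vert _}) _ = <ᵇ-sound
  ⊑-rank< (bot⊑ {edge _ _}) _ = <ᵇ-sound
  ⊑-rank< (bot⊑ {poly _}) _ = <ᵇ-sound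
  ⊑-rank< (⊑top {bot}) _ = <ᵇ-sound
  ⊑-rank< (⊑top {vert _}) _ = <ᵇ-sound
  ⊑-rank< (⊑top {edge _ _}) _ = <ᵇ-sound
  ⊑-rank< (⊑top {poly _}) _ = <ᵇ-sound
  ⊑-rank< (vert⊑edge _) _ = <ᵇ-sound
  ⊑-rank< (edge⊑poly _) _ = <ᵇ-sound
  ⊑-rank< vert⊑poly _ = <ᵇ-sound

  Covers : Face → Face → Face → Set
  Covers x y h = x ⊑ h × h ⊑ y × toℕ (rank h) ≡ suc (toℕ (rank x))

  no-gaps : ∀ {x y} → x ⊑ y → suc (suc (toℕ (rank x))) ≤ toℕ (rank y) → Σ Face (Covers x y)
  no-gaps ⊑-refl gap = ⊥-elim (1+n≰n (≤-trans (n≤1+n _) gap))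
  no-gaps (bot⊑ {edge i β}) _ = vert i , bot⊑ , vert⊑edge (inj₁ refl) , refl
  no-gaps (bot⊑ {poly f}) _ = vert origin , bot⊑ , vert⊑poly , refl
  no-gaps (bot⊑ {top}) _ = vert origin , bot⊑ , ⊑top , refl
  no-gaps (⊑top {bot}) _ = vert origin , bot⊑ , ⊑top , refl
  no-gaps (⊑top {vert j}) _ = edge j false , vert⊑edge (inj₁ refl) , ⊑top , refl
  no-gaps (⊑top {edge i β}) _ = poly (labelled (pos i) β) , edge⊑poly (label-labelled (pos i) β) , ⊑top , refl
  no-gaps (bot⊑ {vert _}) gap = ⊥-elim (<ᵇ-refutes-≤ tt gap)
  no-gaps (⊑top {poly _}) gap = ⊥-elim (<ᵇ-refutes-≤ tt gap)
  no-gaps (⊑top {top}) gap = ⊥-elim (<ᵇ-refutes-≤ tt gap)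
  no-gaps (vert⊑edge _) gap = ⊥-elim (<ᵇ-refutes-≤ tt gap)
  no-gaps (edge⊑poly _) gap = ⊥-elim (<ᵇ-refutes-≤ tt gap)
  no-gaps (vert⊑poly {j} {f}) _ = edge j (label (pos j) f) , vert⊑edge (inj₁ refl) , edge⊑poly refl , refl

  vert-injective : ∀ {i j} → vert i ≡ vert j → i ≡ j
  vert-injective refl = refl

  edge-injective : ∀ {i j β γ} → edge i β ≡ edge j γ → i ≡ j
  edge-injective refl = refl

  poly-injective : ∀ {f f'} → poly f ≡ poly f' → f ≡ f'
  poly-injective refl = refl

  Diamond : Face → Face → Set
  Diamond x y = Σ Face λ h₁ → Σ Face λ h₂ → h₁ ≢ h₂ × Covers x y h₁ × Covers x y h₂ ×
                  (∀ h → Covers x y h → h ≡ h₁ ⊎ h ≡ h₂)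

  diamond : ∀ {x y} → x ⊑ y → toℕ (rank y) ≡ suc (suc (toℕ (rank x))) → Diamond x y
  diamond (bot⊑ {edge i β}) _ =
    vert i , vert (vsuc i) , (λ e → vsuc≢ i (sym (vert-injective e))) ,
    (bot⊑ , vert⊑edge (inj₁ refl) , refl) , (bot⊑ , vert⊑edge (inj₂ refl) , refl) , ends
    where
    ends : ∀ h → Covers bot (edge i β) h → h ≡ vert i ⊎ h ≡ vert (vsuc i)
    ends (vert j) (_ , vert⊑edge (inj₁ refl) , _) = inj₁ refl
    ends (vert j) (_ , vert⊑edge (inj₂ refl) , _) = inj₂ refl
  diamond (vert⊑poly {j} {f}) _ =
    edge j (label (pos j) f) , edge (vpred j) (label (pos (vpred j)) f) ,
    (λ e → vpred≢ j (sym (edge-injective e))) ,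
    (vert⊑edge (inj₁ refl) , edge⊑poly refl , refl) ,
    (vert⊑edge (inj₂ (sym (vsuc-vpred j))) , edge⊑poly refl , refl) , sides
    where
    sides : ∀ h → Covers (vert j) (poly f) h →
            h ≡ edge j (label (pos j) f) ⊎ h ≡ edge (vpred j) (label (pos (vpred j)) f)
    sides (edge i β) (vert⊑edge (inj₁ refl) , edge⊑poly refl , _) = inj₁ refl
    sides (edge i β) (vert⊑edge (inj₂ refl) , edge⊑poly refl , _) rewrite vpred-vsuc i = inj₂ refl
  diamond (⊑top {edge i β}) _ =
    poly f₀ , poly (f₀ ⊕ ker m) , (λ e → f≢f⊕ker m f₀ (poly-injective e)) ,
    (edge⊑poly (label-labelled m β) , ⊑top , refl) ,
    (edge⊑poly (trans (label-⊕ker m f₀) (label-labelled m β)) , ⊑top , refl) , faces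
    where
    m : Fin 3
    m = pos i
    f₀ : Label
    f₀ = labelled m β
    faces : ∀ h → Covers (edge i β) top h → h ≡ poly f₀ ⊎ h ≡ poly (f₀ ⊕ ker m)
    faces (poly f) (edge⊑poly refl , _ , _) = Data.Sum.map (cong poly) (cong poly) (label-fibre m f)

  Between : Face → Face → Face → Set
  Between x y h = x ⊏ h × h ⊏ y

  Linked : Face → Face → Face → Face → Set
  Linked x y h h' = Between x y h × Between x y h' × (h ⊑ h' ⊎ h' ⊑ h)

  Connected : Face → Face → Set
  Connected x y = ∀ h h' → Between x y h → Between x y h' → Star (Linked x y) h h'

  Linked-sym : ∀ {x y h h'} → Linked x y h h' → Linked x y h' h
  Linked-sym (b , b' , c) = b' , b , Data.Sum.swap c

  link : ∀ {x y h h'} → Between x y h → Between x y h' → h ⊑ h' ⊎ h' ⊑ h → Star (Linked x y) h h'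
  link b b' c = (b , b' , c) ◅ ε

  connected-via-hub : ∀ {x y} c → (∀ h → Between x y h → Star (Linked x y) h c) → Connected x y
  connected-via-hub c hub h h' b b' = hub h b ◅◅ Star.reverse Linked-sym (hub h' b')

  polygon-connected : ∀ f → Connected bot (poly f)
  polygon-connected f = connected-via-hub (vert origin) hub
    where
    R : Face → Face → Set
    R = Linked bot (poly f)
    inV : ∀ j → Between bot (poly f) (vert j)
    inV j = (bot⊑ , λ ()) , (vert⊑poly , λ ())
    inE : ∀ i → Between bot (poly f) (edge i (label (pos i) f))
    inE i = (bot⊑ , λ ()) , (edge⊑poly refl , λ ())
    step : ∀ j → Star R (vert j) (vert (vsuc j))
    step j = link (inV j) (inE j) (inj₁ (vert⊑edge (inj₁ refl))) ◅◅
             link (inE j) (inV (vsuc j)) (inj₂ (vert⊑edge (inj₂ refl)))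
    walk : ∀ t → Star R (vert (fold origin vsuc t)) (vert origin)
    walk zero = ε
    walk (suc t) = Star.reverse Linked-sym (step _) ◅◅ walk t
    hub : ∀ h → Between bot (poly f) h → Star R h (vert origin)
    hub (vert j) _ = subst (λ i → Star R (vert i) (vert origin)) (fold-vsuc-index j) (walk (index j))
    hub (edge i β) b@(_ , (edge⊑poly refl , _)) =
      link b (inV i) (inj₂ (vert⊑edge (inj₁ refl))) ◅◅ hub (vert i) (inV i)
    hub bot ((_ , bot≢bot) , _) = ⊥-elim (bot≢bot refl)
    hub (poly _) (_ , (⊑-refl , f≢f)) = ⊥-elim (f≢f refl)

  vertex-figure-connected : ∀ j → Connected (vert j) top
  vertex-figure-connected j = connected-via-hub (poly base) hub
    where
    R : Face → Face → Set
    R = Linked (vert j) top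
    inF : ∀ f → Between (vert j) top (poly f)
    inF f = (vert⊑poly , λ ()) , (⊑top , λ ())
    inE : ∀ {i} β → vert j ⊑ edge i β → Between (vert j) top (edge i β)
    inE β p = (p , λ ()) , (⊑top , λ ())
    flip : ∀ i → vert j ⊑ edge i false → ∀ f → Star R (poly f) (poly (f ⊕ ker (pos i)))
    flip i (vert⊑edge e) f =
      link (inF f) (inE _ (vert⊑edge e)) (inj₂ (edge⊑poly refl)) ◅◅
      link (inE _ (vert⊑edge e)) (inF _) (inj₁ (edge⊑poly (label-⊕ker (pos i) f)))
    forward : vert j ⊑ edge j false
    forward = vert⊑edge (inj₁ refl)
    backward : vert j ⊑ edge (vpred j) false
    backward = vert⊑edge (inj₂ (sym (vsuc-vpred j)))
    -- ker (pos j) and ker (pos (j − 1)) span 𝔽₂²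
    to-base : ∀ q m f → j ≡ (q , m) → Star R (poly f) (poly base)
    to-base q 0F (false , false) refl = ε
    to-base q 0F (true , false) refl = flip j forward _
    to-base q 0F (true , true) refl = flip (vpred j) backward _
    to-base q 0F (false , true) refl = flip j forward _ ◅◅ flip (vpred j) backward _
    to-base q 1F (false , false) refl = ε
    to-base q 1F (false , true) refl = flip j forward _
    to-base q 1F (true , false) refl = flip (vpred j) backward _
    to-base q 1F (true , true) refl = flip j forward _ ◅◅ flip (vpred j) backward _
    to-base q 2F (false , false) refl = ε
    to-base q 2F (true , true) refl = flip j forward _
    to-base q 2F (false , true) refl = flip (vpred j) backward _
    to-base q 2F (true , false) refl = flip j forward _ ◅◅ flip (vpred j) backward _
    hub : ∀ h → Between (vert j) top h → Star R h (poly base)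
    hub (poly f) _ = to-base (proj₁ j) (proj₂ j) f refl
    hub (edge i β) b =
      link b (inF (labelled (pos i) β)) (inj₁ (edge⊑poly (label-labelled (pos i) β))) ◅◅ hub _ (inF _)
    hub (vert _) ((⊑-refl , j≢j) , _) = ⊥-elim (j≢j refl)
    hub top (_ , (_ , top≢top)) = ⊥-elim (top≢top refl)

  whole-connected : Connected bot top
  whole-connected = connected-via-hub (vert origin) hub
    where
    inside : ∀ h → h ≢ bot → h ≢ top → Between bot top h
    inside h h≢bot h≢top = (bot⊑ , λ e → h≢bot (sym e)) , (⊑top , h≢top)
    inF : ∀ f → Between bot top (poly f)
    inF f = inside (poly f) (λ ()) (λ ())
    hub : ∀ h → Between bot top h → Star (Linked bot top) h (vert origin)
    hub (poly f) b = link b (inside (vert origin) (λ ()) (λ ())) (inj₂ vert⊑poly)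
    hub (vert j) b = link b (inF base) (inj₁ vert⊑poly) ◅◅ hub (poly base) (inF base)
    hub (edge i β) b =
      link b (inF (labelled (pos i) β)) (inj₁ (edge⊑poly (label-labelled (pos i) β))) ◅◅ hub (poly _) (inF _)
    hub bot ((_ , bot≢bot) , _) = ⊥-elim (bot≢bot refl)
    hub top (_ , (_ , top≢top)) = ⊥-elim (top≢top refl)

  connected : ∀ {x y} → x ⊑ y → 3 + toℕ (rank x) ≤ toℕ (rank y) → Connected x y
  connected ⊑-refl gap = ⊥-elim (1+n≰n (≤-trans (≤-trans (n≤1+n _) (n≤1+n _)) gap))
  connected (bot⊑ {poly f}) _ = polygon-connected f
  connected (bot⊑ {top}) _ = whole-connected
  connected (⊑top {bot}) _ = whole-connected
  connected (⊑top {vert j}) _ = vertex-figure-connected j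
  connected (bot⊑ {vert _}) gap = ⊥-elim (<ᵇ-refutes-≤ tt gap)
  connected (bot⊑ {edge _ _}) gap = ⊥-elim (<ᵇ-refutes-≤ tt gap)
  connected (⊑top {edge _ _}) gap = ⊥-elim (<ᵇ-refutes-≤ tt gap)
  connected (⊑top {poly _}) gap = ⊥-elim (<ᵇ-refutes-≤ tt gap)
  connected (⊑top {top}) gap = ⊥-elim (<ᵇ-refutes-≤ tt gap)
  connected (vert⊑edge _) gap = ⊥-elim (<ᵇ-refutes-≤ tt gap)
  connected (edge⊑poly _) gap = ⊥-elim (<ᵇ-refutes-≤ tt gap)
  connected vert⊑poly gap = ⊥-elim (<ᵇ-refutes-≤ tt gap)

  FaceCode : Set
  FaceCode = ⊤ ⊎ ⊤ ⊎ Vertex ⊎ (Vertex × Bool) ⊎ Label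

  face↔code : Face ↔ FaceCode
  face↔code = mk↔ₛ′ to from to-from from-to
    where
    to : Face → FaceCode
    to bot = inj₁ tt
    to top = inj₂ (inj₁ tt)
    to (vert j) = inj₂ (inj₂ (inj₁ j))
    to (edge i β) = inj₂ (inj₂ (inj₂ (inj₁ (i , β))))
    to (poly f) = inj₂ (inj₂ (inj₂ (inj₂ f)))
    from : FaceCode → Face
    from (inj₁ _) = bot
    from (inj₂ (inj₁ _)) = top
    from (inj₂ (inj₂ (inj₁ j))) = vert j
    from (inj₂ (inj₂ (inj₂ (inj₁ (i , β))))) = edge i β
    from (inj₂ (inj₂ (inj₂ (inj₂ f)))) = poly f
    to-from : ∀ c → to (from c) ≡ c
    to-from (inj₁ tt) = refl
    to-from (inj₂ (inj₁ tt)) = refl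
    to-from (inj₂ (inj₂ (inj₁ j))) = refl
    to-from (inj₂ (inj₂ (inj₂ (inj₁ (i , β))))) = refl
    to-from (inj₂ (inj₂ (inj₂ (inj₂ f)))) = refl
    from-to : ∀ x → from (to x) ≡ x
    from-to bot = refl
    from-to top = refl
    from-to (vert j) = refl
    from-to (edge i β) = refl
    from-to (poly f) = refl

  vertex↔fin : Vertex ↔ Fin (3 * k)
  vertex↔fin = ↔-sym (↔-trans *↔× (×-comm (Fin 3) (Fin k)))

  label↔fin : Label ↔ Fin 4
  label↔fin = ↔-sym (↔-trans *↔× (2↔Bool ×-↔ 2↔Bool))

  face-count : ℕ
  face-count = 1 + (1 + (3 * k + (3 * k * 2 + 4)))

  fin↔code : Fin face-count ↔ FaceCode
  fin↔code =
    ↔-trans (+↔⊎ {1}) (1↔⊤ ⊎-↔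
    ↔-trans (+↔⊎ {1}) (1↔⊤ ⊎-↔
    ↔-trans (+↔⊎ {3 * k}) (↔-sym vertex↔fin ⊎-↔
    ↔-trans (+↔⊎ {3 * k * 2}) (↔-trans *↔× (↔-sym vertex↔fin ×-↔ 2↔Bool) ⊎-↔ ↔-sym label↔fin))))

  face↔fin : Face ↔ Fin face-count
  face↔fin = ↔-trans face↔code (↔-sym fin↔code)

  opaque
    encode : Face → Fin face-count
    encode = Inverse.to face↔fin

    decode : Fin face-count → Face
    decode = Inverse.from face↔fin

    decode-encode : ∀ x → decode (encode x) ≡ x
    decode-encode = Inverse.strictlyInverseʳ face↔fin

    encode-decode : ∀ a → encode (decode a) ≡ a
    encode-decode = Inverse.strictlyInverseˡ face↔fin

  decode-injective : ∀ {a b} → decode a ≡ decode b → a ≡ b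
  decode-injective {a} {b} e = trans (sym (encode-decode a)) (trans (cong encode e) (encode-decode b))

  encode-injective : ∀ {x y} → encode x ≡ encode y → x ≡ y
  encode-injective {x} {y} e = trans (sym (decode-encode x)) (trans (cong decode e) (decode-encode y))

  le : Fin face-count → Fin face-count → Bool
  le a b = isYes (decode a ⊑? decode b)

  rankᴺ : Fin face-count → Fin 5
  rankᴺ a = rank (decode a)

  ⊑⇒le : ∀ {a b} → decode a ⊑ decode b → T (le a b)
  ⊑⇒le = fromWitness

  le⇒⊑ : ∀ {a b} → T (le a b) → decode a ⊑ decode b
  le⇒⊑ = toWitness

  ⊑⇒le-encode : ∀ {x y} → x ⊑ y → T (le (encode x) (encode y))
  ⊑⇒le-encode {x} {y} p = ⊑⇒le (subst₂ _⊑_ (sym (decode-encode x)) (sym (decode-encode y)) p)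

  le⇒⊑-encode : ∀ {x y} → T (le (encode x) (encode y)) → x ⊑ y
  le⇒⊑-encode {x} {y} p = subst₂ _⊑_ (decode-encode x) (decode-encode y) (le⇒⊑ p)

  rankᴺ-encode : ∀ x → rankᴺ (encode x) ≡ rank x
  rankᴺ-encode x = cong rank (decode-encode x)

  encode-covers : ∀ {a b h} → Covers (decode a) (decode b) h →
                  T (le a (encode h)) × T (le (encode h) b) × toℕ (rankᴺ (encode h)) ≡ suc (toℕ (rankᴺ a))
  encode-covers {a} {b} {h} (p , q , r) =
    ⊑⇒le (subst (decode a ⊑_) (sym (decode-encode h)) p) ,
    ⊑⇒le (subst (_⊑ decode b) (sym (decode-encode h)) q) ,
    trans (cong toℕ (rankᴺ-encode h)) r

  encode-⊏ : ∀ {x y} → x ⊏ y → T (le (encode x) (encode y)) × encode x ≢ encode y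
  encode-⊏ (p , x≢y) = ⊑⇒le-encode p , x≢y ∘ encode-injective

  decode-⊏ : ∀ {a b} → T (le a b) × a ≢ b → decode a ⊏ decode b
  decode-⊏ (p , a≢b) = le⇒⊑ p , a≢b ∘ decode-injective

  encoded : ∀ a {x} → decode a ≡ x → a ≡ encode x
  encoded a e = trans (sym (encode-decode a)) (cong encode e)

  BetweenFin : Fin face-count → Fin face-count → Face → Set
  BetweenFin F G X = (T (le F (encode X)) × F ≢ encode X) × (T (le (encode X) G) × encode X ≢ G)

  encode-between : ∀ F G X → Between (decode F) (decode G) X → BetweenFin F G X
  encode-between F G X (FX , XG) =
    subst (λ a → T (le a (encode X)) × a ≢ encode X) (encode-decode F) (encode-⊏ FX) ,
    subst (λ b → T (le (encode X) b) × encode X ≢ b) (encode-decode G) (encode-⊏ XG)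

  encode-linked : ∀ F G {X Y} → Linked (decode F) (decode G) X Y →
                  BetweenFin F G X × BetweenFin F G Y × (T (le (encode X) (encode Y)) ⊎ T (le (encode Y) (encode X)))
  encode-linked F G {X} {Y} (bX , bY , XY) =
    encode-between F G X bX , encode-between F G Y bY , Data.Sum.map ⊑⇒le-encode ⊑⇒le-encode XY

  P : Polyhedron
  P = record
    { n = face-count
    ; le = le
    ; rank = rankᴺ
    ; ≼-refl = λ F → ⊑⇒le ⊑-refl
    ; ≼-antisym = λ F G p q → decode-injective (⊑-antisym (le⇒⊑ p) (le⇒⊑ q))
    ; ≼-trans = λ F G H p q → ⊑⇒le (⊑-trans (le⇒⊑ p) (le⇒⊑ q))
    ; least = encode bot
    ; least-min = λ F → ⊑⇒le (subst (_⊑ decode F) (sym (decode-encode bot)) bot⊑)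
    ; greatest = encode top
    ; greatest-max = λ F → ⊑⇒le (subst (decode F ⊑_) (sym (decode-encode top)) ⊑top)
    ; least-rank = cong toℕ (rankᴺ-encode bot)
    ; greatest-rank = cong toℕ (rankᴺ-encode top)
    ; rank-strict = λ F G p → let (F⊑G , F≢G) = decode-⊏ p in ⊑-rank< F⊑G F≢G
    ; no-gaps = λ F G p gap → let (h , c) = no-gaps (le⇒⊑ p) gap in encode h , encode-covers c
    ; diamond = λ F G p r → let (h₁ , h₂ , h₁≢h₂ , c₁ , c₂ , two) = diamond (le⇒⊑ p) r in
        encode h₁ , encode h₂ , h₁≢h₂ ∘ encode-injective , encode-covers c₁ , encode-covers c₂ ,
        λ H p q r → Data.Sum.map (encoded H) (encoded H) (two (decode H) (le⇒⊑ p , le⇒⊑ q , r))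
    ; connected = λ F G p gap H H' FH HG FH' H'G →
        subst₂ (Star _) (encode-decode H) (encode-decode H')
          (gmap encode (encode-linked F G)
            (connected (le⇒⊑ p) gap (decode H) (decode H')
              (decode-⊏ FH , decode-⊏ HG) (decode-⊏ FH' , decode-⊏ H'G)))
    }

  open Polyhedron P using (Aut; fwd; bwd; fwd-bwd; bwd-fwd; pres; refl'; IsFlag; Flag; Adjacent; actFlag)

  shear₀ shear₁ : Label → Label
  shear₀ (x , y) = (x xor y , y)
  shear₁ (x , y) = (x , x xor y)

  vertex-action edge-action : Fin 3 → Vertex → Vertex
  vertex-action 0F = vneg₁
  vertex-action 1F = vneg₀
  vertex-action 2F = id
  edge-action 0F = vneg₀
  edge-action 1F = vopp
  edge-action 2F = id

  edge-twist : Fin 3 → Vertex → Bool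
  edge-twist 2F i = label (pos i) (ker 0F)
  edge-twist _ i = false

  label-action : Fin 3 → Label → Label
  label-action 0F = shear₀
  label-action 1F = shear₁
  label-action 2F f = f ⊕ ker 0F

  -- ρ₀ and ρ₁ are the reflections of the 3k-gon fixing the edge {0, 1} and
  -- the vertex 0; ρ₂ fixes every vertex and swaps the two edges of each pair.
  ρ : Fin 3 → Face → Face
  ρ d bot = bot
  ρ d top = top
  ρ d (vert j) = vert (vertex-action d j)
  ρ d (edge i β) = edge (edge-action d i) (β xor edge-twist d i)
  ρ d (poly f) = poly (label-action d f)

  xor-twice : ∀ β t → (β xor t) xor t ≡ β
  xor-twice β t = trans (xor-assoc β t t) (trans (cong (β xor_) (xor-same t)) (xor-identityʳ β))

  vertex-action-involutive : ∀ d j → vertex-action d (vertex-action d j) ≡ j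
  vertex-action-involutive 0F = vneg₁-involutive
  vertex-action-involutive 1F = vneg₀-involutive
  vertex-action-involutive 2F j = refl

  edge-action-involutive : ∀ d i → edge-action d (edge-action d i) ≡ i
  edge-action-involutive 0F = vneg₀-involutive
  edge-action-involutive 1F = vopp-involutive
  edge-action-involutive 2F i = refl

  edge-twist-twice : ∀ d i β → (β xor edge-twist d i) xor edge-twist d (edge-action d i) ≡ β
  edge-twist-twice 0F i β = xor-twice β false
  edge-twist-twice 1F i β = xor-twice β false
  edge-twist-twice 2F i β = xor-twice β _

  label-action-involutive : ∀ d f → label-action d (label-action d f) ≡ f
  label-action-involutive 0F (x , y) = cong (_, y) (xor-twice x y)
  label-action-involutive 1F (false , y) = refl
  label-action-involutive 1F (true , y) = cong (true ,_) (not-involutive y)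
  label-action-involutive 2F (x , y) = cong₂ _,_ (xor-twice x true) (xor-twice y false)

  ρ-involutive : ∀ d x → ρ d (ρ d x) ≡ x
  ρ-involutive d bot = refl
  ρ-involutive d top = refl
  ρ-involutive d (vert j) = cong vert (vertex-action-involutive d j)
  ρ-involutive d (edge i β) = cong₂ edge (edge-action-involutive d i) (edge-twist-twice d i β)
  ρ-involutive d (poly f) = cong poly (label-action-involutive d f)

  vertex-action-ends : ∀ d {j i} → j ≡ i ⊎ j ≡ vsuc i →
                       vertex-action d j ≡ edge-action d i ⊎ vertex-action d j ≡ vsuc (edge-action d i)
  vertex-action-ends 0F (inj₁ refl) = inj₂ refl
  vertex-action-ends 0F {i = i} (inj₂ refl) = inj₁ (vneg₁-vsuc i)
  vertex-action-ends 1F (inj₁ refl) = inj₂ refl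
  vertex-action-ends 1F {i = i} (inj₂ refl) = inj₁ (vneg₀-vsuc i)
  vertex-action-ends 2F e = e

  label-edge-action : ∀ d i f → label (pos (edge-action d i)) (label-action d f) ≡ label (pos i) f xor edge-twist d i
  label-edge-action 0F (q , 0F) (x , y) = sym (xor-identityʳ y)
  label-edge-action 0F (q , 1F) (false , y) = xor-same y
  label-edge-action 0F (q , 1F) (true , false) = refl
  label-edge-action 0F (q , 1F) (true , true) = refl
  label-edge-action 0F (q , 2F) (x , y) = sym (xor-identityʳ _)
  label-edge-action 1F (q , 0F) (false , y) = sym (xor-identityʳ y)
  label-edge-action 1F (q , 0F) (true , false) = refl
  label-edge-action 1F (q , 0F) (true , true) = refl
  label-edge-action 1F (q , 1F) (x , y) = sym (xor-identityʳ x)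
  label-edge-action 1F (q , 2F) (x , y) = sym (xor-identityʳ _)
  label-edge-action 2F (q , 0F) (x , y) = refl
  label-edge-action 2F (q , 1F) (x , y) = refl
  label-edge-action 2F (q , 2F) (false , false) = refl
  label-edge-action 2F (q , 2F) (false , true) = refl
  label-edge-action 2F (q , 2F) (true , false) = refl
  label-edge-action 2F (q , 2F) (true , true) = refl

  ρ-mono : ∀ d {x y} → x ⊑ y → ρ d x ⊑ ρ d y
  ρ-mono d ⊑-refl = ⊑-refl
  ρ-mono d bot⊑ = bot⊑
  ρ-mono d ⊑top = ⊑top
  ρ-mono d vert⊑poly = vert⊑poly
  ρ-mono d (vert⊑edge e) = vert⊑edge (vertex-action-ends d e)
  ρ-mono d (edge⊑poly {i} {β} {f} e) = edge⊑poly (trans (label-edge-action d i f) (cong (_xor edge-twist d i) e))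

  record FaceAut : Set where
    field
      act          : Face → Face
      act⁻¹        : Face → Face
      act-act⁻¹    : ∀ x → act (act⁻¹ x) ≡ x
      act⁻¹-act    : ∀ x → act⁻¹ (act x) ≡ x
      act-mono     : ∀ {x y} → x ⊑ y → act x ⊑ act y
      act-reflects : ∀ {x y} → act x ⊑ act y → x ⊑ y

  open FaceAut public

  act-injective : ∀ a {x y} → act a x ≡ act a y → x ≡ y
  act-injective a {x} {y} e = trans (sym (act⁻¹-act a x)) (trans (cong (act⁻¹ a) e) (act⁻¹-act a y))

  invert : FaceAut → FaceAut
  invert a = record
    { act = act⁻¹ a ; act⁻¹ = act a ; act-act⁻¹ = act⁻¹-act a ; act⁻¹-act = act-act⁻¹ a
    ; act-mono = λ p → act-reflects a (subst₂ _⊑_ (sym (act-act⁻¹ a _)) (sym (act-act⁻¹ a _)) p)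
    ; act-reflects = λ p → subst₂ _⊑_ (act-act⁻¹ a _) (act-act⁻¹ a _) (act-mono a p)
    }

  _∘ᶠ_ : FaceAut → FaceAut → FaceAut
  a ∘ᶠ b = record
    { act = act a ∘ act b ; act⁻¹ = act⁻¹ b ∘ act⁻¹ a
    ; act-act⁻¹ = λ x → trans (cong (act a) (act-act⁻¹ b _)) (act-act⁻¹ a x)
    ; act⁻¹-act = λ x → trans (cong (act⁻¹ b) (act⁻¹-act a _)) (act⁻¹-act b x)
    ; act-mono = act-mono a ∘ act-mono b
    ; act-reflects = act-reflects b ∘ act-reflects a
    }

  ρ-aut : Fin 3 → FaceAut
  ρ-aut d = record
    { act = ρ d ; act⁻¹ = ρ d ; act-act⁻¹ = ρ-involutive d ; act⁻¹-act = ρ-involutive d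
    ; act-mono = ρ-mono d
    ; act-reflects = λ p → subst₂ _⊑_ (ρ-involutive d _) (ρ-involutive d _) (ρ-mono d p)
    }

  -- Every generator is an involution, so a letter acts the same way as its inverse.
  evalFace : Word 3 → Face → Face
  evalFace [] x = x
  evalFace ((d , _) ∷ w) x = ρ d (evalFace w x)

  evalFace-++ : ∀ u v x → evalFace (u ++ v) x ≡ evalFace u (evalFace v x)
  evalFace-++ [] v x = refl
  evalFace-++ ((d , _) ∷ u) v x = cong (ρ d) (evalFace-++ u v x)

  word-aut : Word 3 → FaceAut
  word-aut [] = record
    { act = id ; act⁻¹ = id ; act-act⁻¹ = λ _ → refl ; act⁻¹-act = λ _ → refl
    ; act-mono = id ; act-reflects = id }
  word-aut ((d , _) ∷ w) = ρ-aut d ∘ᶠ word-aut w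

  act-word-aut : ∀ w x → act (word-aut w) x ≡ evalFace w x
  act-word-aut [] x = refl
  act-word-aut ((d , _) ∷ w) x = cong (ρ d) (act-word-aut w x)

  toAut : FaceAut → Aut
  toAut a = record
    { fwd = encode ∘ act a ∘ decode
    ; bwd = encode ∘ act⁻¹ a ∘ decode
    ; fwd-bwd = λ F → trans (cong (encode ∘ act a) (decode-encode _))
                            (trans (cong encode (act-act⁻¹ a _)) (encode-decode F))
    ; bwd-fwd = λ F → trans (cong (encode ∘ act⁻¹ a) (decode-encode _))
                            (trans (cong encode (act⁻¹-act a _)) (encode-decode F))
    ; pres = λ F G p → ⊑⇒le-encode (act-mono a (le⇒⊑ p))
    ; refl' = λ F G p → ⊑⇒le (act-reflects a (le⇒⊑-encode p))
    }

  fromAut : Aut → FaceAut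
  fromAut α = record
    { act = decode ∘ fwd α ∘ encode
    ; act⁻¹ = decode ∘ bwd α ∘ encode
    ; act-act⁻¹ = λ x → trans (cong (decode ∘ fwd α) (encode-decode _))
                              (trans (cong decode (fwd-bwd α _)) (decode-encode x))
    ; act⁻¹-act = λ x → trans (cong (decode ∘ bwd α) (encode-decode _))
                              (trans (cong decode (bwd-fwd α _)) (decode-encode x))
    ; act-mono = λ p → le⇒⊑ (pres α _ _ (⊑⇒le-encode p))
    ; act-reflects = λ p → le⇒⊑-encode (refl' α _ _ (⊑⇒le p))
    }

  ρᴾ : Fin 3 → Aut
  ρᴾ d = toAut (ρ-aut d)

  eval-ρᴾ : ∀ w a → eval P ρᴾ w a ≡ encode (evalFace w (decode a))
  eval-ρᴾ [] a = sym (encode-decode a)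
  eval-ρᴾ ((d , true) ∷ w) a = cong (encode ∘ ρ d) (trans (cong decode (eval-ρᴾ w a)) (decode-encode _))
  eval-ρᴾ ((d , false) ∷ w) a = cong (encode ∘ ρ d) (trans (cong decode (eval-ρᴾ w a)) (decode-encode _))

  -- An automorphism is determined by the image of one flag

  data Chain : ℕ → Face → Set where
    start : ∀ {x} → Chain 0 x
    below : ∀ {r x y} → y ⊏ x → Chain r y → Chain (suc r) x

  Chain-rank : ∀ {r x} → Chain r x → r ≤ toℕ (rank x)
  Chain-rank start = z≤n
  Chain-rank (below (p , y≢x) c) = ≤-trans (s≤s (Chain-rank c)) (⊑-rank< p y≢x)

  vert-Chain : ∀ j → Chain 1 (vert j)
  vert-Chain j = below (bot⊑ , λ ()) start

  edge-Chain : ∀ i β → Chain 2 (edge i β)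
  edge-Chain i β = below (vert⊑edge (inj₁ refl) , λ ()) (vert-Chain i)

  poly-Chain : ∀ f → Chain 3 (poly f)
  poly-Chain f = below (edge⊑poly refl , λ ()) (edge-Chain origin (label 0F f))

  rank-Chain : ∀ x → Chain (toℕ (rank x)) x
  rank-Chain bot = start
  rank-Chain (vert j) = vert-Chain j
  rank-Chain (edge i β) = edge-Chain i β
  rank-Chain (poly f) = poly-Chain f
  rank-Chain top = below (⊑top , λ ()) (poly-Chain base)

  act-Chain : ∀ a {r x} → Chain r x → Chain r (act a x)
  act-Chain a start = start
  act-Chain a (below (p , y≢x) c) = below (act-mono a p , y≢x ∘ act-injective a) (act-Chain a c)

  act-rank : ∀ a x → rank (act a x) ≡ rank x
  act-rank a x = ≤-antisym down up
    where
    up : toℕ (rank x) ≤ toℕ (rank (act a x))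
    up = Chain-rank (act-Chain a (rank-Chain x))
    down : toℕ (rank (act a x)) ≤ toℕ (rank x)
    down = subst (λ y → toℕ (rank (act a x)) ≤ toℕ (rank y)) (act⁻¹-act a x)
                 (Chain-rank (act-Chain (invert a) (rank-Chain (act a x))))

  act-covers : ∀ a {x y h} → Covers x y h → Covers (act a x) (act a y) (act a h)
  act-covers a {x} {h = h} (p , q , r) =
    act-mono a p , act-mono a q ,
    trans (cong toℕ (act-rank a h)) (trans r (cong (λ r → suc (toℕ r)) (sym (act-rank a x))))

  rank-bot : ∀ x → rank x ≡ 0F → x ≡ bot
  rank-bot bot _ = refl

  rank-top : ∀ x → rank x ≡ 4F → x ≡ top
  rank-top top _ = refl

  Agree : FaceAut → FaceAut → Face → Set
  Agree a b x = act a x ≡ act b x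

  one-of-two : ∀ {A : Set} {h₁ h₂ p q c : A} → p ≡ h₁ ⊎ p ≡ h₂ → q ≡ h₁ ⊎ q ≡ h₂ → c ≡ h₁ ⊎ c ≡ h₂ →
               p ≢ c → q ≢ c → p ≡ q
  one-of-two (inj₁ refl) (inj₁ refl) _ _ _ = refl
  one-of-two (inj₂ refl) (inj₂ refl) _ _ _ = refl
  one-of-two (inj₁ refl) (inj₂ refl) (inj₁ refl) p≢c _ = ⊥-elim (p≢c refl)
  one-of-two (inj₁ refl) (inj₂ refl) (inj₂ refl) _ q≢c = ⊥-elim (q≢c refl)
  one-of-two (inj₂ refl) (inj₁ refl) (inj₁ refl) _ q≢c = ⊥-elim (q≢c refl)
  one-of-two (inj₂ refl) (inj₁ refl) (inj₂ refl) p≢c _ = ⊥-elim (p≢c refl)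

  -- act a p, act b p and act a c all lie between act a x and act a y, of which
  -- there are only two faces by the diamond condition.
  agree-diamond : ∀ a b {x y p c} → x ⊑ y → toℕ (rank y) ≡ suc (suc (toℕ (rank x))) →
                  Covers x y p → Covers x y c → p ≢ c →
                  Agree a b x → Agree a b y → Agree a b c → Agree a b p
  agree-diamond a b {x} {y} {p} {c} x⊑y r cp cc p≢c ax ay ac with diamond (act-mono a x⊑y) r'
    where
    r' : toℕ (rank (act a y)) ≡ suc (suc (toℕ (rank (act a x))))
    r' = trans (cong toℕ (act-rank a y)) (trans r (cong (λ r → suc (suc (toℕ r))) (sym (act-rank a x))))
  ... | _ , _ , _ , _ , _ , only-two =
    one-of-two (only-two _ (act-covers a cp)) (only-two _ b-covers) (only-two _ (act-covers a cc))
               (p≢c ∘ act-injective a) (p≢c ∘ act-injective b ∘ λ e → trans e ac)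
    where
    b-covers : Covers (act a x) (act a y) (act b p)
    b-covers = subst₂ (λ x' y' → Covers x' y' (act b p)) (sym ax) (sym ay) (act-covers b cp)

  switching-face : Vertex → Label
  switching-face (q , 0F) = (true , true)
  switching-face (q , 1F) = (true , false)
  switching-face (q , 2F) = (false , true)

  switching-face-here : ∀ i → label (pos i) (switching-face i) ≡ true
  switching-face-here (q , 0F) = refl
  switching-face-here (q , 1F) = refl
  switching-face-here (q , 2F) = refl

  switching-face-back : ∀ i → label (pos (vpred i)) (switching-face i) ≡ false
  switching-face-back (q , 0F) = refl
  switching-face-back (q , 1F) = refl
  switching-face-back (q , 2F) = refl

  agree-bot : ∀ a b → Agree a b bot
  agree-bot a b = trans (rank-bot _ (act-rank a bot)) (sym (rank-bot _ (act-rank b bot)))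

  agree-top : ∀ a b → Agree a b top
  agree-top a b = trans (rank-top _ (act-rank a top)) (sym (rank-top _ (act-rank b top)))

  -- Walking around the 2-face base, the diamonds bot ⊑ edge j and vert (j + 1) ⊑ poly base
  -- pass agreement on to vert (j + 1) and then to edge (j + 1) false.
  agree-around-base : ∀ a b → Agree a b (vert origin) → Agree a b (edge origin false) → Agree a b (poly base) →
                      ∀ j → Agree a b (vert j) × Agree a b (edge j false)
  agree-around-base a b a-vert a-edge a-poly j =
    subst (λ j → Agree a b (vert j) × Agree a b (edge j false)) (fold-vsuc-index j) (walk (index j))
    where
    walk : ∀ t → Agree a b (vert (fold origin vsuc t)) × Agree a b (edge (fold origin vsuc t) false)
    walk zero = a-vert , a-edge
    walk (suc t) = next-vert , next-edge
      where
      i : Vertex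
      i = fold origin vsuc t
      next-vert : Agree a b (vert (vsuc i))
      next-vert = agree-diamond a b {p = vert (vsuc i)} {c = vert i} (bot⊑ {edge i false}) refl
        (bot⊑ , vert⊑edge (inj₂ refl) , refl) (bot⊑ , vert⊑edge (inj₁ refl) , refl)
        (vsuc≢ i ∘ vert-injective) (agree-bot a b) (proj₂ (walk t)) (proj₁ (walk t))
      next-edge : Agree a b (edge (vsuc i) false)
      next-edge = agree-diamond a b {p = edge (vsuc i) false} {c = edge i false} (vert⊑poly {vsuc i} {base}) refl
        (vert⊑edge (inj₁ refl) , edge⊑poly (label-base (pos (vsuc i))) , refl)
        (vert⊑edge (inj₂ refl) , edge⊑poly (label-base (pos i)) , refl)
        (vsuc≢ i ∘ edge-injective) next-vert a-poly (proj₂ (walk t))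

  agree-everywhere : ∀ a b → Agree a b (vert origin) → Agree a b (edge origin false) → Agree a b (poly base) →
                     ∀ x → Agree a b x
  agree-everywhere a b a-vert a-edge a-poly = agree
    where
    a-vert-all : ∀ j → Agree a b (vert j)
    a-vert-all j = proj₁ (agree-around-base a b a-vert a-edge a-poly j)
    a-edge-false : ∀ i → Agree a b (edge i false)
    a-edge-false i = proj₂ (agree-around-base a b a-vert a-edge a-poly i)
    a-ker : ∀ m → Agree a b (poly (ker m))
    a-ker m = agree-diamond a b {p = poly (ker m)} {c = poly base} (⊑top {edge (zero , m) false}) refl
      (edge⊑poly (label-ker m) , ⊑top , refl) (edge⊑poly (label-base m) , ⊑top , refl)
      (ker≢base m) (a-edge-false _) (agree-top a b) a-poly
      where
      ker≢base : ∀ m → poly (ker m) ≢ poly base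
      ker≢base 0F ()
      ker≢base 1F ()
      ker≢base 2F ()
    a-poly-all : ∀ f → Agree a b (poly f)
    a-poly-all (false , false) = a-poly
    a-poly-all (true , false) = a-ker 0F
    a-poly-all (false , true) = a-ker 1F
    a-poly-all (true , true) = a-ker 2F
    a-edge-all : ∀ i β → Agree a b (edge i β)
    a-edge-all i false = a-edge-false i
    a-edge-all i true = agree-diamond a b {p = edge i true} {c = edge (vpred i) false}
      (vert⊑poly {i} {switching-face i}) refl
      (vert⊑edge (inj₁ refl) , edge⊑poly (switching-face-here i) , refl)
      (vert⊑edge (inj₂ (sym (vsuc-vpred i))) , edge⊑poly (switching-face-back i) , refl)
      (λ ()) (a-vert-all i) (a-poly-all _) (a-edge-false _)
    agree : ∀ x → Agree a b x
    agree bot = agree-bot a b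
    agree top = agree-top a b
    agree (vert j) = a-vert-all j
    agree (edge i β) = a-edge-all i β
    agree (poly f) = a-poly-all f

  -- The relators act trivially

  act-letters : ∀ {A : Set} → (Fin 3 → A → A) → Word 3 → A → A
  act-letters f [] x = x
  act-letters f ((d , _) ∷ w) x = f d (act-letters f w x)

  twist : Word 3 → Vertex → Bool
  twist [] i = false
  twist ((d , _) ∷ w) i = twist w i xor edge-twist d (act-letters edge-action w i)

  evalFace-bot : ∀ w → evalFace w bot ≡ bot
  evalFace-bot [] = refl
  evalFace-bot ((d , _) ∷ w) = cong (ρ d) (evalFace-bot w)

  evalFace-top : ∀ w → evalFace w top ≡ top
  evalFace-top [] = refl
  evalFace-top ((d , _) ∷ w) = cong (ρ d) (evalFace-top w)

  evalFace-vert : ∀ w j → evalFace w (vert j) ≡ vert (act-letters vertex-action w j)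
  evalFace-vert [] j = refl
  evalFace-vert ((d , _) ∷ w) j = cong (ρ d) (evalFace-vert w j)

  evalFace-edge : ∀ w i β → evalFace w (edge i β) ≡ edge (act-letters edge-action w i) (β xor twist w i)
  evalFace-edge [] i β = cong (edge i) (sym (xor-identityʳ β))
  evalFace-edge ((d , _) ∷ w) i β = trans (cong (ρ d) (evalFace-edge w i β)) (cong (edge _) (xor-assoc β _ _))

  evalFace-poly : ∀ w f → evalFace w (poly f) ≡ poly (act-letters label-action w f)
  evalFace-poly [] f = refl
  evalFace-poly ((d , _) ∷ w) f = cong (ρ d) (evalFace-poly w f)

  ActsTrivially : Word 3 → Set
  ActsTrivially w = ∀ x → evalFace w x ≡ x

  acts-trivially-from-parts : ∀ w → (∀ j → act-letters vertex-action w j ≡ j) → (∀ i → act-letters edge-action w i ≡ i) →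
                   (∀ i → twist w i ≡ false) → (∀ f → act-letters label-action w f ≡ f) → ActsTrivially w
  acts-trivially-from-parts w on-vert on-edge no-twist on-label bot = evalFace-bot w
  acts-trivially-from-parts w on-vert on-edge no-twist on-label top = evalFace-top w
  acts-trivially-from-parts w on-vert on-edge no-twist on-label (vert j) = trans (evalFace-vert w j) (cong vert (on-vert j))
  acts-trivially-from-parts w on-vert on-edge no-twist on-label (edge i β) =
    trans (evalFace-edge w i β) (cong₂ edge (on-edge i) (trans (cong (β xor_) (no-twist i)) (xor-identityʳ β)))
  acts-trivially-from-parts w on-vert on-edge no-twist on-label (poly f) = trans (evalFace-poly w f) (cong poly (on-label f))

  rotation : ℕ → Word 3
  rotation c = concat (replicate c (g 0F ∷ g 1F ∷ []))

  rotate-label : Label → Label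
  rotate-label f = shear₀ (shear₁ f)

  rotation-vert : ∀ c j → act-letters vertex-action (rotation c) j ≡ fold j vsuc c
  rotation-vert zero j = refl
  rotation-vert (suc c) j = trans (vneg₁-vneg₀ _) (cong vsuc (rotation-vert c j))

  rotation-edge : ∀ c i → act-letters edge-action (rotation c) i ≡ fold i vsuc c
  rotation-edge zero i = refl
  rotation-edge (suc c) i = trans (vneg₀-vopp _) (cong vsuc (rotation-edge c i))

  rotation-twist : ∀ c i → twist (rotation c) i ≡ false
  rotation-twist zero i = refl
  rotation-twist (suc c) i = trans (xor-twice _ false) (rotation-twist c i)

  rotation-label : ∀ c f → act-letters label-action (rotation c) f ≡ fold f rotate-label c
  rotation-label zero f = refl
  rotation-label (suc c) f = cong rotate-label (rotation-label c f)

  rotate-label-3 : ∀ f → fold f rotate-label 3 ≡ f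
  rotate-label-3 (false , false) = refl
  rotate-label-3 (false , true) = refl
  rotate-label-3 (true , false) = refl
  rotate-label-3 (true , true) = refl

  rotation-full-turn : ActsTrivially (rotation (3 * k))
  rotation-full-turn = acts-trivially-from-parts (rotation (3 * k))
    (λ j → trans (rotation-vert (3 * k) j) (fold-vsuc-period j))
    (λ i → trans (rotation-edge (3 * k) i) (fold-vsuc-period i))
    (rotation-twist (3 * k))
    (λ f → trans (rotation-label (3 * k) f)
                 (trans (cong (fold f rotate-label) (*-comm 3 k)) (fold-periodic rotate-label 3 rotate-label-3 f k)))

  relators-act-trivially : ∀ {r} → r ∈ ΛRelators k → ActsTrivially r
  relators-act-trivially (here refl) = ρ-involutive 0F
  relators-act-trivially (there (here refl)) = ρ-involutive 1F
  relators-act-trivially (there (there (here refl))) = ρ-involutive 2F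
  relators-act-trivially (there (there (there (here refl)))) = rotation-full-turn
  relators-act-trivially (there (there (there (there (here refl))))) =
    acts-trivially-from-parts (concat (replicate 2 (g 0F ∷ g 2F ∷ []))) vneg₁-involutive vneg₀-involutive
      (λ { (q , 0F) → refl ; (q , 1F) → refl ; (q , 2F) → refl })
      (λ { (false , false) → refl ; (false , true) → refl ; (true , false) → refl ; (true , true) → refl })
  relators-act-trivially (there (there (there (there (there (here refl)))))) =
    acts-trivially-from-parts (concat (replicate 4 (g 1F ∷ g 2F ∷ [])))
      (λ j → trans (cong (vneg₀ ∘ vneg₀) (vneg₀-involutive j)) (vneg₀-involutive j))
      (λ i → trans (cong (vopp ∘ vopp) (vopp-involutive i)) (vopp-involutive i))
      (λ { (q , 0F) → refl ; (q , 1F) → refl ; (q , 2F) → refl })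
      (λ { (false , false) → refl ; (false , true) → refl ; (true , false) → refl ; (true , true) → refl })
  relators-act-trivially (there (there (there (there (there (there (here refl))))))) =
    acts-trivially-from-parts (g 0F ∷ g 1F ∷ g 2F ∷ g 1F ∷ g 0F ∷ g 1F ∷ g 2F ∷ g 1F ∷ g 2F ∷ [])
      (λ j → trans (cong (vneg₁ ∘ vneg₀ ∘ vneg₀ ∘ vneg₁) (vneg₀-involutive j))
                   (trans (cong vneg₁ (vneg₀-involutive (vneg₁ j))) (vneg₁-involutive j)))
      (λ i → trans (cong (vneg₀ ∘ vopp ∘ vopp ∘ vneg₀) (vopp-involutive i))
                   (trans (cong vneg₀ (vopp-involutive (vneg₀ i))) (vneg₀-involutive i)))
      (λ { (q , 0F) → refl ; (q , 1F) → refl ; (q , 2F) → refl })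
      (λ { (false , false) → refl ; (false , true) → refl ; (true , false) → refl ; (true , true) → refl })

  evalFace-respects-~ : ∀ {u v} → u ~[ ΛRelators k ] v → ∀ x → evalFace u x ≡ evalFace v x
  evalFace-respects-~ ~refl x = refl
  evalFace-respects-~ (~sym p) x = sym (evalFace-respects-~ p x)
  evalFace-respects-~ (~trans p q) x = trans (evalFace-respects-~ p x) (evalFace-respects-~ q x)
  evalFace-respects-~ (~cong {u = u} {u' = u'} {v = v} {v' = v'} p q) x = begin
    evalFace (u ++ v) x          ≡⟨ evalFace-++ u v x ⟩
    evalFace u (evalFace v x)    ≡⟨ evalFace-respects-~ p _ ⟩
    evalFace u' (evalFace v x)   ≡⟨ cong (evalFace u') (evalFace-respects-~ q x) ⟩
    evalFace u' (evalFace v' x)  ≡⟨ evalFace-++ u' v' x ⟨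
    evalFace (u' ++ v') x        ∎
    where open ≡-Reasoning
  evalFace-respects-~ (~cancel d b) x = ρ-involutive d x
  evalFace-respects-~ (~rel r∈R) x = relators-act-trivially r∈R x

  -- Normal forms in Λ(k)

  infix 4 _≈_
  _≈_ : Word 3 → Word 3 → Set
  u ≈ v = u ~[ ΛRelators k ] v

  ≈-setoid : Setoid 0ℓ 0ℓ
  ≈-setoid = record
    { Carrier = Word 3 ; _≈_ = _≈_
    ; isEquivalence = record { refl = ~refl ; sym = ~sym ; trans = ~trans } }

  module ≈-Reasoning = SetoidReasoning ≈-setoid

  ≡⇒≈ : ∀ {u v} → u ≡ v → u ≈ v
  ≡⇒≈ refl = ~refl

  ≈-prefix : ∀ u {w w'} → w ≈ w' → u ++ w ≈ u ++ w'
  ≈-prefix u = ~cong ~refl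

  ≈-suffix : ∀ w {u u'} → u ≈ u' → u ++ w ≈ u' ++ w
  ≈-suffix w p = ~cong p ~refl

  drop-relator : ∀ p s {r} → r ∈ ΛRelators k → p ++ r ++ s ≈ p ++ s
  drop-relator p s r∈ = ≈-prefix p (≈-suffix s (~rel r∈))

  square∈ : ∀ i → (g i ∷ g i ∷ []) ∈ ΛRelators k
  square∈ 0F = here refl
  square∈ 1F = there (here refl)
  square∈ 2F = there (there (here refl))

  rotation∈ : rotation (3 * k) ∈ ΛRelators k
  rotation∈ = there (there (there (here refl)))

  ρ₀ρ₂∈ : concat (replicate 2 (g 0F ∷ g 2F ∷ [])) ∈ ΛRelators k
  ρ₀ρ₂∈ = there (there (there (there (here refl))))

  ρ₁ρ₂∈ : concat (replicate 4 (g 1F ∷ g 2F ∷ [])) ∈ ΛRelators k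
  ρ₁ρ₂∈ = there (there (there (there (there (here refl)))))

  ρ₀ρ₁ρ₂ρ₁ρ₀ρ₁ρ₂ρ₁ρ₂∈ : (g 0F ∷ g 1F ∷ g 2F ∷ g 1F ∷ g 0F ∷ g 1F ∷ g 2F ∷ g 1F ∷ g 2F ∷ []) ∈ ΛRelators k
  ρ₀ρ₁ρ₂ρ₁ρ₀ρ₁ρ₂ρ₁ρ₂∈ = there (there (there (there (there (there (here refl))))))

  -- Free reduction with respect to the relators ρᵢ², applied to positive letters.
  reduce-cons : Letter 3 → Word 3 → Word 3
  reduce-cons (i , true) ((j , true) ∷ w) with i Data.Fin.≟ j
  ... | yes _ = w
  ... | no _ = (i , true) ∷ (j , true) ∷ w
  reduce-cons l w = l ∷ w

  reduce-cons-sound : ∀ l w → l ∷ w ≈ reduce-cons l w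
  reduce-cons-sound (i , true) ((j , true) ∷ w) with i Data.Fin.≟ j
  ... | yes refl = drop-relator [] w (square∈ i)
  ... | no _ = ~refl
  reduce-cons-sound (i , true) [] = ~refl
  reduce-cons-sound (i , true) ((j , false) ∷ w) = ~refl
  reduce-cons-sound (i , false) w = ~refl

  reduce : Word 3 → Word 3
  reduce [] = []
  reduce (l ∷ w) = reduce-cons l (reduce w)

  reduce-sound : ∀ w → w ≈ reduce w
  reduce-sound [] = ~refl
  reduce-sound (l ∷ w) = ~trans (≈-prefix (l ∷ []) (reduce-sound w)) (reduce-cons-sound l (reduce w))

  insert-relator : ∀ p s {r} → r ∈ ΛRelators k → p ++ s ≈ reduce (p ++ r ++ s)
  insert-relator p s r∈ = ~trans (~sym (drop-relator p s r∈)) (reduce-sound _)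

  inverse-letter : ∀ i → (i , false) ∷ [] ≈ g i ∷ []
  inverse-letter i =
    ~trans (~sym (drop-relator ((i , false) ∷ []) [] (square∈ i))) (≈-suffix (g i ∷ []) (~cancel i false))

  -- translation v fixes every vertex and sends the 2-face f to f ⊕ v.
  translation : Label → Word 3
  translation (false , false) = []
  translation (true , false) = g 2F ∷ []
  translation (true , true) = g 1F ∷ g 2F ∷ g 1F ∷ []
  translation (false , true) = g 2F ∷ g 1F ∷ g 2F ∷ g 1F ∷ []

  ρ₂ρ₁²≈ρ₁ρ₂² : g 2F ∷ g 1F ∷ g 2F ∷ g 1F ∷ [] ≈ g 1F ∷ g 2F ∷ g 1F ∷ g 2F ∷ []
  ρ₂ρ₁²≈ρ₁ρ₂² = insert-relator [] _ ρ₁ρ₂∈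

  translation-ρ₂ : ∀ v → translation v ++ g 2F ∷ [] ≈ translation (label-action 2F v)
  translation-ρ₂ (false , false) = ~refl
  translation-ρ₂ (true , false) = reduce-sound _
  translation-ρ₂ (true , true) = ~sym ρ₂ρ₁²≈ρ₁ρ₂²
  translation-ρ₂ (false , true) = ~trans (≈-prefix (g 2F ∷ []) (~sym ρ₂ρ₁²≈ρ₁ρ₂²)) (reduce-sound _)

  translation-ρ₀ : ∀ v → translation v ++ g 0F ∷ [] ≈ g 0F ∷ translation (label-action 0F v)
  translation-ρ₀ (false , false) = ~refl
  translation-ρ₀ (true , false) = insert-relator [] _ ρ₀ρ₂∈
  translation-ρ₀ (false , true) = insert-relator [] _ ρ₀ρ₁ρ₂ρ₁ρ₀ρ₁ρ₂ρ₁ρ₂∈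
  translation-ρ₀ (true , true) =
    ~trans (insert-relator [] _ ρ₀ρ₂∈) (insert-relator (g 0F ∷ g 2F ∷ g 0F ∷ []) _ ρ₀ρ₁ρ₂ρ₁ρ₀ρ₁ρ₂ρ₁ρ₂∈)

  translation-ρ₁ : ∀ v → translation v ++ g 1F ∷ [] ≈ g 1F ∷ translation (label-action 1F v)
  translation-ρ₁ (false , false) = ~refl
  translation-ρ₁ (true , false) = ~sym (reduce-sound _)
  translation-ρ₁ (true , true) = reduce-sound _
  translation-ρ₁ (false , true) =
    ~trans (reduce-sound _) (~sym (~trans (≈-prefix (g 1F ∷ []) ρ₂ρ₁²≈ρ₁ρ₂²) (reduce-sound _)))

  rotation-snoc : ∀ c → rotation (suc c) ≡ rotation c ++ g 0F ∷ g 1F ∷ []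
  rotation-snoc zero = refl
  rotation-snoc (suc c) = cong (λ w → g 0F ∷ g 1F ∷ w) (rotation-snoc c)

  rotation-suc-ρ₁ : ∀ c → rotation (suc c) ++ g 1F ∷ [] ≈ rotation c ++ g 0F ∷ []
  rotation-suc-ρ₁ c = begin
    rotation (suc c) ++ g 1F ∷ []                  ≡⟨ cong (_++ g 1F ∷ []) (rotation-snoc c) ⟩
    (rotation c ++ g 0F ∷ g 1F ∷ []) ++ g 1F ∷ []  ≡⟨ ++-assoc (rotation c) _ _ ⟩
    rotation c ++ g 0F ∷ g 1F ∷ g 1F ∷ []          ≡⟨ sym (++-assoc (rotation c) _ _) ⟩
    (rotation c ++ g 0F ∷ []) ++ g 1F ∷ g 1F ∷ []  ≈⟨ drop-relator (rotation c ++ g 0F ∷ []) [] (square∈ 1F) ⟩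
    (rotation c ++ g 0F ∷ []) ++ []                ≡⟨ ++-identityʳ _ ⟩
    rotation c ++ g 0F ∷ []                        ∎
    where open ≈-Reasoning

  rotation-vsuc-ρ₁ : ∀ b → rotation (index (vsuc b)) ++ g 1F ∷ [] ≈ rotation (index b) ++ g 0F ∷ []
  rotation-vsuc-ρ₁ b with index-vsuc b
  ... | inj₁ e rewrite e = rotation-suc-ρ₁ (index b)
  ... | inj₂ (e , full) rewrite e = begin
    g 1F ∷ []                                ≈⟨ drop-relator [] (g 1F ∷ []) rotation∈ ⟨
    rotation (3 * k) ++ g 1F ∷ []            ≡⟨ cong (λ c → rotation c ++ g 1F ∷ []) full ⟨
    rotation (suc (index b)) ++ g 1F ∷ []    ≈⟨ rotation-suc-ρ₁ (index b) ⟩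
    rotation (index b) ++ g 0F ∷ []          ∎
    where open ≈-Reasoning

  rotation-ρ₀ρ₁ : ∀ a → rotation (index a) ++ g 0F ∷ g 1F ∷ [] ≈ rotation (index (vsuc a))
  rotation-ρ₀ρ₁ a with index-vsuc a
  ... | inj₁ e rewrite e = ≡⇒≈ (sym (rotation-snoc (index a)))
  ... | inj₂ (e , full) rewrite e = begin
    rotation (index a) ++ g 0F ∷ g 1F ∷ []   ≡⟨ rotation-snoc (index a) ⟨
    rotation (suc (index a))                 ≡⟨ cong rotation full ⟩
    rotation (3 * k)                         ≈⟨ ~rel rotation∈ ⟩
    []                                       ∎
    where open ≈-Reasoning

  -- A normal form (s , a , v) stands for (ρ₀ρ₁)^a ρ₀^s t_v, where t_v is the translation by v.
  NormalForm : Set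
  NormalForm = Bool × Vertex × Label

  reflection : Bool → Word 3
  reflection false = []
  reflection true = g 0F ∷ []

  nf-word : NormalForm → Word 3
  nf-word (s , a , v) = (rotation (index a) ++ reflection s) ++ translation v

  nf-step : NormalForm → Fin 3 → NormalForm
  nf-step (s , a , v) 2F = (s , a , label-action 2F v)
  nf-step (false , a , v) 0F = (true , a , label-action 0F v)
  nf-step (true , a , v) 0F = (false , a , label-action 0F v)
  nf-step (false , a , v) 1F = (true , vpred a , label-action 1F v)
  nf-step (true , a , v) 1F = (false , vsuc a , label-action 1F v)

  through-translation : ∀ s a {v x v' w} → translation v ++ g x ∷ [] ≈ g x ∷ translation v' →
                        (rotation (index a) ++ reflection s) ++ g x ∷ [] ≈ w →
                        nf-word (s , a , v) ++ g x ∷ [] ≈ w ++ translation v'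
  through-translation s a {v} {x} {v'} {w} p q = begin
    (D ++ translation v) ++ g x ∷ []   ≡⟨ ++-assoc D (translation v) _ ⟩
    D ++ translation v ++ g x ∷ []     ≈⟨ ≈-prefix D p ⟩
    D ++ g x ∷ translation v'          ≡⟨ ++-assoc D (g x ∷ []) _ ⟨
    (D ++ g x ∷ []) ++ translation v'  ≈⟨ ≈-suffix (translation v') q ⟩
    w ++ translation v'                ∎
    where
    open ≈-Reasoning
    D : Word 3
    D = rotation (index a) ++ reflection s

  nf-step-sound : ∀ σ x → nf-word σ ++ g x ∷ [] ≈ nf-word (nf-step σ x)
  nf-step-sound (s , a , v) 2F =
    ~trans (≡⇒≈ (++-assoc (rotation (index a) ++ reflection s) (translation v) _))
           (≈-prefix (rotation (index a) ++ reflection s) (translation-ρ₂ v))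
  nf-step-sound (false , a , v) 0F = through-translation false a (translation-ρ₀ v)
    (≡⇒≈ (++-assoc (rotation (index a)) [] _))
  nf-step-sound (true , a , v) 0F = through-translation true a (translation-ρ₀ v)
    (~trans (≡⇒≈ (++-assoc (rotation (index a)) _ _)) (drop-relator (rotation (index a)) [] (square∈ 0F)))
  nf-step-sound (false , a , v) 1F = through-translation false a (translation-ρ₁ v)
    (~trans (≡⇒≈ (++-assoc (rotation (index a)) [] _))
            (subst (λ b → rotation (index b) ++ g 1F ∷ [] ≈ rotation (index (vpred a)) ++ g 0F ∷ [])
                   (vsuc-vpred a) (rotation-vsuc-ρ₁ (vpred a))))
  nf-step-sound (true , a , v) 1F = through-translation true a (translation-ρ₁ v)
    (~trans (≡⇒≈ (++-assoc (rotation (index a)) _ _))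
            (~trans (rotation-ρ₀ρ₁ a) (≡⇒≈ (sym (++-identityʳ _)))))

  nf-run : NormalForm → Word 3 → NormalForm
  nf-run σ [] = σ
  nf-run σ ((x , _) ∷ w) = nf-run (nf-step σ x) w

  nf-run-sound : ∀ σ w → nf-word σ ++ w ≈ nf-word (nf-run σ w)
  nf-run-sound σ [] = ≡⇒≈ (++-identityʳ (nf-word σ))
  nf-run-sound σ ((x , b) ∷ w) = begin
    nf-word σ ++ (x , b) ∷ w             ≡⟨ ++-assoc (nf-word σ) _ w ⟨
    (nf-word σ ++ (x , b) ∷ []) ++ w     ≈⟨ ≈-suffix w (≈-prefix (nf-word σ) (letter≈generator b)) ⟩
    (nf-word σ ++ g x ∷ []) ++ w         ≈⟨ ≈-suffix w (nf-step-sound σ x) ⟩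
    nf-word (nf-step σ x) ++ w           ≈⟨ nf-run-sound (nf-step σ x) w ⟩
    nf-word (nf-run (nf-step σ x) w)     ∎
    where
    open ≈-Reasoning
    letter≈generator : ∀ b → (x , b) ∷ [] ≈ g x ∷ []
    letter≈generator true = ~refl
    letter≈generator false = inverse-letter x

  identity : NormalForm
  identity = (false , origin , base)

  normal-form : Word 3 → NormalForm
  normal-form = nf-run identity

  ≈-normal-form : ∀ w → w ≈ nf-word (normal-form w)
  ≈-normal-form = nf-run-sound identity

  act-letters-++ : ∀ {A : Set} (f : Fin 3 → A → A) u v x →
                   act-letters f (u ++ v) x ≡ act-letters f u (act-letters f v x)
  act-letters-++ f [] v x = refl
  act-letters-++ f ((h , _) ∷ u) v x = cong (f h) (act-letters-++ f u v x)

  evalFace-injective : ∀ w {x y} → evalFace w x ≡ evalFace w y → x ≡ y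
  evalFace-injective w {x} {y} e =
    act-injective (word-aut w) (trans (act-word-aut w x) (trans e (sym (act-word-aut w y))))

  translation-vert : ∀ v j → act-letters vertex-action (translation v) j ≡ j
  translation-vert (false , false) j = refl
  translation-vert (true , false) j = refl
  translation-vert (true , true) j = vneg₀-involutive j
  translation-vert (false , true) j = vneg₀-involutive j

  translation-base : ∀ v → evalFace (translation v) (poly base) ≡ poly v
  translation-base (false , false) = refl
  translation-base (true , false) = refl
  translation-base (true , true) = refl
  translation-base (false , true) = refl

  vertex-image : Bool → Vertex → Vertex → Vertex
  vertex-image s a j = fold (act-letters vertex-action (reflection s) j) vsuc (index a)

  nf-vert : ∀ s a v j → evalFace (nf-word (s , a , v)) (vert j) ≡ vert (vertex-image s a j)
  nf-vert s a v j = trans (evalFace-vert (nf-word (s , a , v)) j) (cong vert (begin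
    act-letters vertex-action ((R ++ reflection s) ++ translation v) j
      ≡⟨ act-letters-++ vertex-action (R ++ reflection s) (translation v) j ⟩
    act-letters vertex-action (R ++ reflection s) (act-letters vertex-action (translation v) j)
      ≡⟨ cong (act-letters vertex-action (R ++ reflection s)) (translation-vert v j) ⟩
    act-letters vertex-action (R ++ reflection s) j
      ≡⟨ act-letters-++ vertex-action R (reflection s) j ⟩
    act-letters vertex-action R (act-letters vertex-action (reflection s) j)
      ≡⟨ rotation-vert (index a) _ ⟩
    fold (act-letters vertex-action (reflection s) j) vsuc (index a) ∎))
    where
    open ≡-Reasoning
    R : Word 3
    R = rotation (index a)

  nf-base : ∀ s a v →
            evalFace (nf-word (s , a , v)) (poly base) ≡ evalFace (rotation (index a) ++ reflection s) (poly v)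
  nf-base s a v = trans (evalFace-++ (rotation (index a) ++ reflection s) (translation v) (poly base))
                        (cong (evalFace (rotation (index a) ++ reflection s)) (translation-base v))

  -- The images of the vertices 0 and 1 determine the reflection part and the rotation
  -- of a normal form.
  vertex-images : Bool → Vertex → Vertex × Vertex
  vertex-images false a = (a , vsuc a)
  vertex-images true a = (vsuc a , a)

  vertex-image-0-1 : ∀ s a → (vertex-image s a origin , vertex-image s a (vsuc origin)) ≡ vertex-images s a
  vertex-image-0-1 false a = cong₂ _,_ (fold-vsuc-index a) (fold-vsuc-index-from-1 a)
  vertex-image-0-1 true a = cong₂ _,_
    (trans (cong (λ j → fold (vsuc j) vsuc (index a)) vneg₀-origin) (fold-vsuc-index-from-1 a))
    (trans (cong (λ j → fold j vsuc (index a)) (trans (vneg₁-vsuc origin) vneg₀-origin)) (fold-vsuc-index a))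

  vertex-images-injective : ∀ s s' a a' → vertex-images s a ≡ vertex-images s' a' → (s , a) ≡ (s' , a')
  vertex-images-injective false false a .a refl = refl
  vertex-images-injective true true a .a refl = refl
  vertex-images-injective false true a a' e =
    ⊥-elim (vsuc²≢ a (trans (cong (vsuc ∘ proj₂) e) (sym (cong proj₁ e))))
  vertex-images-injective true false a a' e =
    ⊥-elim (vsuc²≢ a' (trans (cong (vsuc ∘ proj₂) (sym e)) (cong proj₁ e)))

  nf-faithful : ∀ σ τ → (∀ x → evalFace (nf-word σ) x ≡ evalFace (nf-word τ) x) → σ ≡ τ
  nf-faithful (s , a , v) (s' , a' , v') same with vertex-images-injective s s' a a' same-images
    where
    same-image : ∀ j → vertex-image s a j ≡ vertex-image s' a' j
    same-image j = vert-injective (trans (sym (nf-vert s a v j)) (trans (same (vert j)) (nf-vert s' a' v' j)))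
    same-images : vertex-images s a ≡ vertex-images s' a'
    same-images = trans (sym (vertex-image-0-1 s a))
                        (trans (cong₂ _,_ (same-image origin) (same-image (vsuc origin))) (vertex-image-0-1 s' a'))
  ... | refl = cong (λ v → (s , a , v))
    (poly-injective (evalFace-injective (rotation (index a) ++ reflection s)
      (trans (sym (nf-base s a v)) (trans (same (poly base)) (nf-base s a v')))))

  evalFace-eval : ∀ w x → eval P ρᴾ w (encode x) ≡ encode (evalFace w x)
  evalFace-eval w x = trans (eval-ρᴾ w (encode x)) (cong (encode ∘ evalFace w) (decode-encode x))

  presentation-sound : ∀ u v → u ~[ ΛRelators k ] v → ∀ a → eval P ρᴾ u a ≡ eval P ρᴾ v a
  presentation-sound u v u~v a =
    trans (eval-ρᴾ u a) (trans (cong encode (evalFace-respects-~ u~v (decode a))) (sym (eval-ρᴾ v a)))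

  presentation-faithful : ∀ u v → (∀ a → eval P ρᴾ u a ≡ eval P ρᴾ v a) → u ~[ ΛRelators k ] v
  presentation-faithful u v same = begin
    u                        ≈⟨ ≈-normal-form u ⟩
    nf-word (normal-form u)  ≡⟨ cong nf-word (nf-faithful (normal-form u) (normal-form v) same-nf) ⟩
    nf-word (normal-form v)  ≈⟨ ≈-normal-form v ⟨
    v                        ∎
    where
    open ≈-Reasoning
    same-face : ∀ x → evalFace u x ≡ evalFace v x
    same-face x = encode-injective (trans (sym (evalFace-eval u x)) (trans (same (encode x)) (evalFace-eval v x)))
    same-nf : ∀ x → evalFace (nf-word (normal-form u)) x ≡ evalFace (nf-word (normal-form v)) x
    same-nf x = trans (evalFace-respects-~ (~sym (≈-normal-form u)) x)
                      (trans (same-face x) (evalFace-respects-~ (≈-normal-form v) x))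

  translation-edge : ∀ v i β → evalFace (translation v) (edge i β) ≡ edge i (β xor label (pos i) v)
  translation-edge v i β =
    trans (evalFace-edge (translation v) i β) (cong₂ edge (fixes v i) (cong (β xor_) (twists v i)))
    where
    fixes : ∀ v i → act-letters edge-action (translation v) i ≡ i
    fixes (false , false) i = refl
    fixes (true , false) i = refl
    fixes (true , true) i = vopp-involutive i
    fixes (false , true) i = vopp-involutive i
    twists : ∀ v i → twist (translation v) i ≡ label (pos i) v
    twists (false , false) (q , 0F) = refl
    twists (false , false) (q , 1F) = refl
    twists (false , false) (q , 2F) = refl
    twists (true , false) (q , 0F) = refl
    twists (true , false) (q , 1F) = refl
    twists (true , false) (q , 2F) = refl
    twists (true , true) (q , 0F) = refl
    twists (true , true) (q , 1F) = refl
    twists (true , true) (q , 2F) = refl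
    twists (false , true) (q , 0F) = refl
    twists (false , true) (q , 1F) = refl
    twists (false , true) (q , 2F) = refl

  rotation-vert-face : ∀ c j → evalFace (rotation c) (vert j) ≡ vert (fold j vsuc c)
  rotation-vert-face c j = trans (evalFace-vert (rotation c) j) (cong vert (rotation-vert c j))

  rotation-edge-face : ∀ c i β → evalFace (rotation c) (edge i β) ≡ edge (fold i vsuc c) β
  rotation-edge-face c i β = trans (evalFace-edge (rotation c) i β)
    (cong₂ edge (rotation-edge c i) (trans (cong (β xor_) (rotation-twist c i)) (xor-identityʳ β)))

  rotation-base : ∀ c → evalFace (rotation c) (poly base) ≡ poly base
  rotation-base c = trans (evalFace-poly (rotation c) base) (cong poly (trans (rotation-label c base) (fixed c)))
    where
    fixed : ∀ c → fold base rotate-label c ≡ base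
    fixed zero = refl
    fixed (suc c) = cong rotate-label (fixed c)

  edge-tail : Bool → Vertex → Vertex
  edge-tail true j = j
  edge-tail false j = vpred j

  edge-tail-⊑ : ∀ c j {β} → vert j ⊑ edge (edge-tail c j) β
  edge-tail-⊑ true j = vert⊑edge (inj₁ refl)
  edge-tail-⊑ false j = vert⊑edge (inj₂ (sym (vsuc-vpred j)))

  edge-tail-of : ∀ {j i β} → vert j ⊑ edge i β → edge-tail (isYes (i ≟ᵥ j)) j ≡ i
  edge-tail-of {j} {i} (vert⊑edge j∈i) with i ≟ᵥ j | j∈i
  ... | yes refl | _ = refl
  ... | no i≢j | inj₁ refl = ⊥-elim (i≢j refl)
  ... | no _ | inj₂ refl = vpred-vsuc i

  edge-tail-direction : ∀ c j → isYes (edge-tail c j ≟ᵥ j) ≡ c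
  edge-tail-direction true j with j ≟ᵥ j
  ... | yes _ = refl
  ... | no j≢j = ⊥-elim (j≢j refl)
  edge-tail-direction false j with vpred j ≟ᵥ j
  ... | yes e = ⊥-elim (vpred≢ j e)
  ... | no _ = refl

  -- Flags, type and tightness

  FlagCode : Set
  FlagCode = Bool × Vertex × Label

  -- the edge of f at j, leaving j forwards if c and backwards otherwise
  flag-edge : Bool → Vertex → Label → Face
  flag-edge c j f = edge (edge-tail c j) (label (pos (edge-tail c j)) f)

  flag-edge-of : ∀ {j i β f} → vert j ⊑ edge i β → edge i β ⊑ poly f →
                 flag-edge (isYes (i ≟ᵥ j)) j f ≡ edge i β
  flag-edge-of j⊑e (edge⊑poly refl) rewrite edge-tail-of j⊑e = refl

  Coded : FlagCode → Face → Face → Face → Set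
  Coded (c , j , f) v e p = v ≡ vert j × e ≡ flag-edge c j f × p ≡ poly f

  vertex-of edge-start : Face → Vertex
  vertex-of (vert j) = j
  vertex-of _ = origin
  edge-start (edge i _) = i
  edge-start _ = origin

  edge-bit : Face → Bool
  edge-bit (edge _ β) = β
  edge-bit _ = false

  label-of : Face → Label
  label-of (poly f) = f
  label-of _ = base

  vertex-of-rank : ∀ x → rank x ≡ 1F → x ≡ vert (vertex-of x)
  vertex-of-rank (vert j) _ = refl

  edge-of-rank : ∀ x → rank x ≡ 2F → x ≡ edge (edge-start x) (edge-bit x)
  edge-of-rank (edge i β) _ = refl

  label-of-rank : ∀ x → rank x ≡ 3F → x ≡ poly (label-of x)
  label-of-rank (poly f) _ = refl

  flag-code : Face → Face → Face → FlagCode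
  flag-code v e p = (isYes (edge-start e ≟ᵥ vertex-of v) , vertex-of v , label-of p)

  flag-code-sound : ∀ {v e p} → rank v ≡ 1F → rank e ≡ 2F → rank p ≡ 3F → v ⊑ e → e ⊑ p →
                    Coded (flag-code v e p) v e p
  flag-code-sound {v} {e} {p} v-rank e-rank p-rank v⊑e e⊑p =
    v≡ , sym (trans (flag-edge-of (subst₂ _⊑_ v≡ e≡ v⊑e) (subst₂ _⊑_ e≡ p≡ e⊑p)) (sym e≡)) , p≡
    where
    v≡ : v ≡ vert (vertex-of v)
    v≡ = vertex-of-rank v v-rank
    e≡ : e ≡ edge (edge-start e) (edge-bit e)
    e≡ = edge-of-rank e e-rank
    p≡ : p ≡ poly (label-of p)
    p≡ = label-of-rank p p-rank

  turn : Bool → Word 3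
  turn true = []
  turn false = g 1F ∷ []

  flag-word : FlagCode → Word 3
  flag-word (c , j , f) = translation f ++ rotation (index j) ++ turn c

  evalFace-flag-word : ∀ c j f x → evalFace (flag-word (c , j , f)) x ≡
                       evalFace (translation f) (evalFace (rotation (index j)) (evalFace (turn c) x))
  evalFace-flag-word c j f x =
    trans (evalFace-++ (translation f) _ x) (cong (evalFace (translation f)) (evalFace-++ (rotation (index j)) (turn c) x))

  flag-word-vert : ∀ c j f → evalFace (flag-word (c , j , f)) (vert origin) ≡ vert j
  flag-word-vert c j f = begin
    evalFace (flag-word (c , j , f)) (vert origin)
      ≡⟨ evalFace-flag-word c j f _ ⟩
    evalFace (translation f) (evalFace (rotation (index j)) (evalFace (turn c) (vert origin)))
      ≡⟨ cong (evalFace (translation f) ∘ evalFace (rotation (index j))) (turn-origin c) ⟩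
    evalFace (translation f) (evalFace (rotation (index j)) (vert origin))
      ≡⟨ cong (evalFace (translation f)) (rotation-vert-face (index j) origin) ⟩
    evalFace (translation f) (vert (fold origin vsuc (index j)))
      ≡⟨ evalFace-vert (translation f) _ ⟩
    vert (act-letters vertex-action (translation f) (fold origin vsuc (index j)))
      ≡⟨ cong vert (trans (translation-vert f _) (fold-vsuc-index j)) ⟩
    vert j ∎
    where
    open ≡-Reasoning
    turn-origin : ∀ c → evalFace (turn c) (vert origin) ≡ vert origin
    turn-origin true = refl
    turn-origin false = cong vert vneg₀-origin

  flag-word-poly : ∀ c j f → evalFace (flag-word (c , j , f)) (poly base) ≡ poly f
  flag-word-poly c j f = begin
    evalFace (flag-word (c , j , f)) (poly base)
      ≡⟨ evalFace-flag-word c j f _ ⟩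
    evalFace (translation f) (evalFace (rotation (index j)) (evalFace (turn c) (poly base)))
      ≡⟨ cong (evalFace (translation f) ∘ evalFace (rotation (index j))) (turn-base c) ⟩
    evalFace (translation f) (evalFace (rotation (index j)) (poly base))
      ≡⟨ cong (evalFace (translation f)) (rotation-base (index j)) ⟩
    evalFace (translation f) (poly base)
      ≡⟨ translation-base f ⟩
    poly f ∎
    where
    open ≡-Reasoning
    turn-base : ∀ c → evalFace (turn c) (poly base) ≡ poly base
    turn-base true = refl
    turn-base false = refl

  flag-word-edge : ∀ c j f → evalFace (flag-word (c , j , f)) (edge origin false) ≡ flag-edge c j f
  flag-word-edge c j f = begin
    evalFace (flag-word (c , j , f)) (edge origin false)
      ≡⟨ evalFace-flag-word c j f _ ⟩
    evalFace (translation f) (evalFace (rotation (index j)) (evalFace (turn c) (edge origin false)))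
      ≡⟨ cong (evalFace (translation f) ∘ evalFace (rotation (index j))) (turn-edge c) ⟩
    evalFace (translation f) (evalFace (rotation (index j)) (edge (edge-tail c origin) false))
      ≡⟨ cong (evalFace (translation f)) (rotation-edge-face (index j) _ false) ⟩
    evalFace (translation f) (edge i false)
      ≡⟨ translation-edge f i false ⟩
    edge i (label (pos i) f)
      ≡⟨ cong (λ i → edge i (label (pos i) f)) (lands c) ⟩
    flag-edge c j f ∎
    where
    open ≡-Reasoning
    i : Vertex
    i = fold (edge-tail c origin) vsuc (index j)
    turn-edge : ∀ c → evalFace (turn c) (edge origin false) ≡ edge (edge-tail c origin) false
    turn-edge true = refl
    turn-edge false = refl
    vpred-vsuc-commute : ∀ j → vpred (vsuc j) ≡ vsuc (vpred j)
    vpred-vsuc-commute j = trans (vpred-vsuc j) (sym (vsuc-vpred j))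
    lands : ∀ c → fold (edge-tail c origin) vsuc (index j) ≡ edge-tail c j
    lands true = fold-vsuc-index j
    lands false =
      trans (sym (fold-comm vpred vsuc vpred-vsuc-commute origin (index j))) (cong vpred (fold-vsuc-index j))

  BaseImage : FaceAut → FlagCode → Set
  BaseImage a σ = Coded σ (act a (vert origin)) (act a (edge origin false)) (act a (poly base))

  base-image-unique : ∀ a b σ → BaseImage a σ → BaseImage b σ → ∀ x → Agree a b x
  base-image-unique a b σ (av , ae , ap) (bv , be , bp) =
    agree-everywhere a b (trans av (sym bv)) (trans ae (sym be)) (trans ap (sym bp))

  base-flag-code : FaceAut → FlagCode
  base-flag-code a = flag-code (act a (vert origin)) (act a (edge origin false)) (act a (poly base))

  base-image : ∀ a → BaseImage a (base-flag-code a)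
  base-image a = flag-code-sound (act-rank a (vert origin)) (act-rank a (edge origin false)) (act-rank a (poly base))
                   (act-mono a (vert⊑edge (inj₁ refl))) (act-mono a (edge⊑poly (label-base 0F)))

  flag-word-base-image : ∀ σ → BaseImage (word-aut (flag-word σ)) σ
  flag-word-base-image σ@(c , j , f) =
    trans (act-word-aut (flag-word σ) _) (flag-word-vert c j f) ,
    trans (act-word-aut (flag-word σ) _) (flag-word-edge c j f) ,
    trans (act-word-aut (flag-word σ) _) (flag-word-poly c j f)

  word-of : FaceAut → Word 3
  word-of a = flag-word (base-flag-code a)

  act-word-of : ∀ a x → act a x ≡ evalFace (word-of a) x
  act-word-of a x =
    trans (base-image-unique a (word-aut (word-of a)) (base-flag-code a) (base-image a) (flag-word-base-image _) x)
          (act-word-aut (word-of a) x)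

  presentation-onto : ∀ (α : Aut) → Σ (Word 3) λ w → ∀ a → eval P ρᴾ w a ≡ fwd α a
  presentation-onto α = word-of (fromAut α) , λ a → begin
    eval P ρᴾ (word-of (fromAut α)) a                   ≡⟨ eval-ρᴾ (word-of (fromAut α)) a ⟩
    encode (evalFace (word-of (fromAut α)) (decode a))  ≡⟨ cong encode (act-word-of (fromAut α) (decode a)) ⟨
    encode (decode (fwd α (encode (decode a))))         ≡⟨ encode-decode _ ⟩
    fwd α (encode (decode a))                           ≡⟨ cong (fwd α) (encode-decode a) ⟩
    fwd α a                                             ∎
    where open ≡-Reasoning

  Σ-≡-irrelevant : ∀ {A : Set} {B : A → Set} → (∀ a (p q : B a) → p ≡ q) →
                   ∀ {a a' p q} → a ≡ a' → _≡_ {A = Σ A B} (a , p) (a' , q)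
  Σ-≡-irrelevant irr {a} {p = p} {q} refl = cong (a ,_) (irr a p q)

  Fin-irrelevant : ∀ {m} {i j : Fin m} (p q : i ≡ j) → p ≡ q
  Fin-irrelevant = Decidable⇒UIP.≡-irrelevant Data.Fin._≟_

  IsFlag-irrelevant : ∀ Φ (p q : IsFlag Φ) → p ≡ q
  IsFlag-irrelevant Φ (a0 , a1 , a2 , a3 , a4 , b0 , b1 , b2 , b3) (c0 , c1 , c2 , c3 , c4 , d0 , d1 , d2 , d3)
    rewrite Fin-irrelevant a0 c0 | Fin-irrelevant a1 c1 | Fin-irrelevant a2 c2 | Fin-irrelevant a3 c3
          | Fin-irrelevant a4 c4 | T-irrelevant b0 d0 | T-irrelevant b1 d1 | T-irrelevant b2 d2
          | T-irrelevant b3 d3 = refl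

  encode-from : ∀ {a x} → decode a ≡ x → encode x ≡ a
  encode-from {a} e = trans (cong encode (sym e)) (encode-decode a)

  code-faces : FlagCode → Vec Face 5
  code-faces (c , j , f) = bot ∷ vert j ∷ flag-edge c j f ∷ poly f ∷ top ∷ []

  code-is-flag : ∀ σ → IsFlag (Vec.map encode (code-faces σ))
  code-is-flag (c , j , f) =
    rankᴺ-encode bot , rankᴺ-encode (vert j) , rankᴺ-encode (flag-edge c j f) , rankᴺ-encode (poly f) ,
    rankᴺ-encode top , ⊑⇒le-encode bot⊑ , ⊑⇒le-encode (edge-tail-⊑ c j) , ⊑⇒le-encode (edge⊑poly refl) ,
    ⊑⇒le-encode ⊑top

  code-flag : FlagCode → Flag
  code-flag σ = Vec.map encode (code-faces σ) , code-is-flag σ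

  flag-code-of : Flag → FlagCode
  flag-code-of (Φ , _) = flag-code (decode (lookup Φ 1F)) (decode (lookup Φ 2F)) (decode (lookup Φ 3F))

  flag-code-of-code-flag : ∀ σ → flag-code-of (code-flag σ) ≡ σ
  flag-code-of-code-flag (c , j , f)
    rewrite decode-encode (vert j) | decode-encode (flag-edge c j f) | decode-encode (poly f) =
    cong (_, j , f) (edge-tail-direction c j)

  code-flag-flag-code-of : ∀ Φ → code-flag (flag-code-of Φ) ≡ Φ
  code-flag-flag-code-of ((a0 ∷ a1 ∷ a2 ∷ a3 ∷ a4 ∷ []) , (r0 , r1 , r2 , r3 , r4 , _ , l12 , l23 , _)) =
    Σ-≡-irrelevant IsFlag-irrelevant
      (encode-from (rank-bot (decode a0) r0) ∷≡ encode-from (proj₁ middle) ∷≡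
       encode-from (proj₁ (proj₂ middle)) ∷≡ encode-from (proj₂ (proj₂ middle)) ∷≡
       encode-from (rank-top (decode a4) r4) ∷≡ refl)
    where
    middle : Coded (flag-code (decode a1) (decode a2) (decode a3)) (decode a1) (decode a2) (decode a3)
    middle = flag-code-sound r1 r2 r3 (le⇒⊑ l12) (le⇒⊑ l23)

  flags↔codes : Flag ↔ FlagCode
  flags↔codes = mk↔ₛ′ flag-code-of code-flag flag-code-of-code-flag code-flag-flag-code-of

  codes↔fin : FlagCode ↔ Fin (2 * (3 * k) * 4)
  codes↔fin = ↔-sym (↔-trans *↔× (↔-trans (↔-trans *↔× (2↔Bool ×-↔ ↔-sym vertex↔fin) ×-↔ ↔-sym label↔fin)
                                           (×-assoc _ Bool Vertex Label)))

  tight : Tight P (3 * k) 4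
  tight = ↔-trans flags↔codes codes↔fin

  ranked-below-irrelevant : ∀ r b a (p q : toℕ (rankᴺ a) ≡ r × T (le a b)) → p ≡ q
  ranked-below-irrelevant r b a (p , p') (q , q') = cong₂ _,_ (≡-irrelevant p q) (T-irrelevant p' q')

  ranked-above-irrelevant : ∀ r b a (p q : toℕ (rankᴺ a) ≡ r × T (le b a)) → p ≡ q
  ranked-above-irrelevant r b a (p , p') (q , q') = cong₂ _,_ (≡-irrelevant p q) (T-irrelevant p' q')

  vertices-of-face : ∀ F → toℕ (rankᴺ F) ≡ 3 →
                     Σ (Fin face-count) (λ v → toℕ (rankᴺ v) ≡ 1 × T (le v F)) ↔ Vertex
  vertices-of-face F F-rank = mk↔ₛ′ to from to-from from-to
    where
    F≡ : decode F ≡ poly (label-of (decode F))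
    F≡ = label-of-rank (decode F) (toℕ-injective F-rank)
    to : Σ (Fin face-count) (λ v → toℕ (rankᴺ v) ≡ 1 × T (le v F)) → Vertex
    to (v , _) = vertex-of (decode v)
    from : Vertex → Σ (Fin face-count) (λ v → toℕ (rankᴺ v) ≡ 1 × T (le v F))
    from j = encode (vert j) , cong toℕ (rankᴺ-encode (vert j)) ,
             ⊑⇒le (subst₂ _⊑_ (sym (decode-encode (vert j))) (sym F≡) vert⊑poly)
    to-from : ∀ j → to (from j) ≡ j
    to-from j = cong vertex-of (decode-encode (vert j))
    from-to : ∀ v → from (to v) ≡ v
    from-to (v , v-rank , _) =
      Σ-≡-irrelevant (ranked-below-irrelevant 1 F) (encode-from (vertex-of-rank (decode v) (toℕ-injective v-rank)))

  edges-at-vertex : ∀ v → toℕ (rankᴺ v) ≡ 1 →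
                    Σ (Fin face-count) (λ e → toℕ (rankᴺ e) ≡ 2 × T (le v e)) ↔ (Bool × Bool)
  edges-at-vertex v v-rank = mk↔ₛ′ to from to-from from-to
    where
    j : Vertex
    j = vertex-of (decode v)
    v≡ : decode v ≡ vert j
    v≡ = vertex-of-rank (decode v) (toℕ-injective v-rank)
    to : Σ (Fin face-count) (λ e → toℕ (rankᴺ e) ≡ 2 × T (le v e)) → Bool × Bool
    to (e , _) = isYes (edge-start (decode e) ≟ᵥ j) , edge-bit (decode e)
    from : Bool × Bool → Σ (Fin face-count) (λ e → toℕ (rankᴺ e) ≡ 2 × T (le v e))
    from (c , β) = encode (edge (edge-tail c j) β) , cong toℕ (rankᴺ-encode (edge (edge-tail c j) β)) ,
                   ⊑⇒le
                     (subst₂ _⊑_ (sym v≡) (sym (decode-encode (edge (edge-tail c j) β))) (edge-tail-⊑ c j))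
    to-from : ∀ cβ → to (from cβ) ≡ cβ
    to-from (c , β) rewrite decode-encode (edge (edge-tail c j) β) = cong (_, β) (edge-tail-direction c j)
    from-to : ∀ e → from (to e) ≡ e
    from-to (e , e-rank , v⊑e) =
      Σ-≡-irrelevant (ranked-above-irrelevant 2 v) (encode-from (trans e≡ (cong₂ edge (sym tail≡) refl)))
      where
      e≡ : decode e ≡ edge (edge-start (decode e)) (edge-bit (decode e))
      e≡ = edge-of-rank (decode e) (toℕ-injective e-rank)
      tail≡ : edge-tail (isYes (edge-start (decode e) ≟ᵥ j)) j ≡ edge-start (decode e)
      tail≡ = edge-tail-of (subst₂ _⊑_ v≡ e≡ (le⇒⊑ v⊑e))

  has-type : HasType P (3 * k) 4
  has-type = (λ F r → ↔-trans (vertices-of-face F r) vertex↔fin) ,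
             (λ v r → ↔-trans (edges-at-vertex v r) label↔fin)

  base-code : FlagCode
  base-code = (true , origin , base)

  flag-word-images : ∀ σ → Vec.map (act (word-aut (flag-word σ))) (code-faces base-code) ≡ code-faces σ
  flag-word-images σ with flag-word-base-image σ
  ... | on-vert , on-edge , on-poly =
    trans (act-word-aut (flag-word σ) bot) (evalFace-bot (flag-word σ)) ∷≡ on-vert ∷≡ on-edge ∷≡ on-poly ∷≡
    trans (act-word-aut (flag-word σ) top) (evalFace-top (flag-word σ)) ∷≡ refl

  actFlag-toAut : ∀ a {m} (xs : Vec Face m) →
                  Vec.map (fwd (toAut a)) (Vec.map encode xs) ≡ Vec.map encode (Vec.map (act a) xs)
  actFlag-toAut a [] = refl
  actFlag-toAut a (x ∷ xs) = cong (encode ∘ act a) (decode-encode x) ∷≡ actFlag-toAut a xs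

  map-act-transfer : ∀ a b {m} (xs : Vec Face m) →
                     Vec.map (act (b ∘ᶠ invert a)) (Vec.map (act a) xs) ≡ Vec.map (act b) xs
  map-act-transfer a b [] = refl
  map-act-transfer a b (x ∷ xs) = cong (act b) (act⁻¹-act a x) ∷≡ map-act-transfer a b xs

  -- Regularity and the rotation subgroup

  regular : Regular P
  regular Φ Ψ = toAut (B ∘ᶠ invert A) , moves
    where
    A B : FaceAut
    A = word-aut (flag-word (flag-code-of Φ))
    B = word-aut (flag-word (flag-code-of Ψ))
    moves : actFlag (toAut (B ∘ᶠ invert A)) (proj₁ Φ) ≡ proj₁ Ψ
    moves = begin
      actFlag (toAut (B ∘ᶠ invert A)) (proj₁ Φ)
        ≡⟨ cong (actFlag (toAut (B ∘ᶠ invert A)) ∘ proj₁) (code-flag-flag-code-of Φ) ⟨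
      actFlag (toAut (B ∘ᶠ invert A)) (Vec.map encode (code-faces (flag-code-of Φ)))
        ≡⟨ actFlag-toAut (B ∘ᶠ invert A) _ ⟩
      Vec.map encode (Vec.map (act (B ∘ᶠ invert A)) (code-faces (flag-code-of Φ)))
        ≡⟨ cong (Vec.map encode ∘ Vec.map (act (B ∘ᶠ invert A))) (flag-word-images (flag-code-of Φ)) ⟨
      Vec.map encode (Vec.map (act (B ∘ᶠ invert A)) (Vec.map (act A) (code-faces base-code)))
        ≡⟨ cong (Vec.map encode) (map-act-transfer A B (code-faces base-code)) ⟩
      Vec.map encode (Vec.map (act B) (code-faces base-code))
        ≡⟨ cong (Vec.map encode) (flag-word-images (flag-code-of Ψ)) ⟩
      Vec.map encode (code-faces (flag-code-of Ψ))
        ≡⟨ cong proj₁ (code-flag-flag-code-of Ψ) ⟩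
      proj₁ Ψ ∎
      where open ≡-Reasoning

  toAut-IsFlag : ∀ a Φ → IsFlag Φ → IsFlag (actFlag (toAut a) Φ)
  toAut-IsFlag a (x0 ∷ x1 ∷ x2 ∷ x3 ∷ x4 ∷ []) (r0 , r1 , r2 , r3 , r4 , l01 , l12 , l23 , l34) =
    keeps x0 r0 , keeps x1 r1 , keeps x2 r2 , keeps x3 r3 , keeps x4 r4 ,
    pres (toAut a) x0 x1 l01 , pres (toAut a) x1 x2 l12 , pres (toAut a) x2 x3 l23 , pres (toAut a) x3 x4 l34
    where
    keeps : ∀ x {r} → rankᴺ x ≡ r → rankᴺ (fwd (toAut a) x) ≡ r
    keeps x e = trans (rankᴺ-encode (act a (decode x))) (trans (act-rank a (decode x)) e)

  base-flag : Flag
  base-flag = code-flag base-code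

  ρᴾ-encode : ∀ i x → fwd (ρᴾ i) (encode x) ≡ encode (ρ i x)
  ρᴾ-encode i x = cong (encode ∘ ρ i) (decode-encode x)

  ρᴾ-fixes : ∀ i {x} → ρ i x ≡ x → fwd (ρᴾ i) (encode x) ≡ encode x
  ρᴾ-fixes i {x} e = trans (ρᴾ-encode i x) (cong encode e)

  ρᴾ-moves : ∀ i {x} → x ≢ ρ i x → encode x ≢ fwd (ρᴾ i) (encode x)
  ρᴾ-moves i {x} x≢ρx e = x≢ρx (encode-injective (trans e (ρᴾ-encode i x)))

  base-flag-image : ∀ i → IsFlag (actFlag (ρᴾ i) (proj₁ base-flag))
  base-flag-image i = toAut-IsFlag (ρ-aut i) (proj₁ base-flag) (proj₂ base-flag)

  base-flag-adjacent : ∀ i → Adjacent i (proj₁ base-flag) (actFlag (ρᴾ i) (proj₁ base-flag))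
  base-flag-adjacent 0F = proj₂ base-flag , base-flag-image 0F , ρᴾ-moves 0F (λ ()) ,
    ρᴾ-fixes 0F refl ∷≡ refl ∷≡ ρᴾ-fixes 0F (cong (λ i → edge i false) vneg₀-origin) ∷≡ ρᴾ-fixes 0F refl ∷≡
    ρᴾ-fixes 0F refl ∷≡ refl
  base-flag-adjacent 1F = proj₂ base-flag , base-flag-image 1F , ρᴾ-moves 1F (λ ()) ,
    ρᴾ-fixes 1F refl ∷≡ ρᴾ-fixes 1F (cong vert vneg₀-origin) ∷≡ refl ∷≡ ρᴾ-fixes 1F refl ∷≡ ρᴾ-fixes 1F refl ∷≡ refl
  base-flag-adjacent 2F = proj₂ base-flag , base-flag-image 2F , ρᴾ-moves 2F (λ ()) ,
    ρᴾ-fixes 2F refl ∷≡ ρᴾ-fixes 2F refl ∷≡ ρᴾ-fixes 2F refl ∷≡ refl ∷≡ ρᴾ-fixes 2F refl ∷≡ refl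

  eval-++ : ∀ {m} (a : Fin m → Aut) u v x → eval P a (u ++ v) x ≡ eval P a u (eval P a v x)
  eval-++ a [] v x = refl
  eval-++ a ((i , true) ∷ u) v x = cong (fwd (a i)) (eval-++ a u v x)
  eval-++ a ((i , false) ∷ u) v x = cong (bwd (a i)) (eval-++ a u v x)

  expand-letter : Letter 2 → Word 3
  expand-letter (0F , true) = g 0F ∷ g 1F ∷ []
  expand-letter (0F , false) = g 1F ∷ g 0F ∷ []
  expand-letter (1F , true) = g 1F ∷ g 2F ∷ []
  expand-letter (1F , false) = g 2F ∷ g 1F ∷ []

  expand : Word 2 → Word 3
  expand [] = []
  expand (l ∷ w) = expand-letter l ++ expand w

  expand-++ : ∀ u v → expand (u ++ v) ≡ expand u ++ expand v
  expand-++ [] v = refl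
  expand-++ (l ∷ u) v =
    trans (cong (expand-letter l ++_) (expand-++ u v)) (sym (++-assoc (expand-letter l) (expand u) (expand v)))

  eval-expand : ∀ (σ : Fin 2 → Aut) → (∀ l a → eval P σ (l ∷ []) a ≡ eval P ρᴾ (expand-letter l) a) →
                ∀ w a → eval P σ w a ≡ eval P ρᴾ (expand w) a
  eval-expand σ letters [] a = refl
  eval-expand σ letters (l ∷ w) a = begin
    eval P σ (l ∷ w) a                                    ≡⟨ eval-++ σ (l ∷ []) w a ⟩
    eval P σ (l ∷ []) (eval P σ w a)                      ≡⟨ letters l _ ⟩
    eval P ρᴾ (expand-letter l) (eval P σ w a)            ≡⟨ cong (eval P ρᴾ (expand-letter l)) (eval-expand σ letters w a) ⟩
    eval P ρᴾ (expand-letter l) (eval P ρᴾ (expand w) a)  ≡⟨ eval-++ ρᴾ (expand-letter l) (expand w) a ⟨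
    eval P ρᴾ (expand (l ∷ w)) a                          ∎
    where open ≡-Reasoning

  -- letter 0 is ρ₀ρ₁ and letter 1 is ρ₁ρ₂: ρ₂ = (ρ₁ρ₂)(ρ₀ρ₁)⁻¹(ρ₁ρ₂)(ρ₀ρ₁)⁻¹
  ρ₂-by-rotations : Word 2
  ρ₂-by-rotations = (1F , true) ∷ (0F , false) ∷ (1F , true) ∷ (0F , false) ∷ []

  rotation-word : Fin 3 → Word 2
  rotation-word 0F = (0F , true) ∷ (1F , true) ∷ ρ₂-by-rotations
  rotation-word 1F = (1F , true) ∷ ρ₂-by-rotations
  rotation-word 2F = ρ₂-by-rotations

  expand-ρ₂-by-rotations : expand ρ₂-by-rotations ≈ g 2F ∷ []
  expand-ρ₂-by-rotations = ~sym (~trans (insert-relator [] (g 2F ∷ []) ρ₀ρ₂∈)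
                                        (insert-relator (g 0F ∷ []) (g 2F ∷ g 0F ∷ []) ρ₀ρ₁ρ₂ρ₁ρ₀ρ₁ρ₂ρ₁ρ₂∈))

  expand-rotation-word : ∀ i → expand (rotation-word i) ≈ g i ∷ []
  expand-rotation-word 0F = ~trans (≈-prefix (g 0F ∷ g 1F ∷ g 1F ∷ g 2F ∷ []) expand-ρ₂-by-rotations) (reduce-sound _)
  expand-rotation-word 1F = ~trans (≈-prefix (g 1F ∷ g 2F ∷ []) expand-ρ₂-by-rotations) (reduce-sound _)
  expand-rotation-word 2F = expand-ρ₂-by-rotations

  to-rotations : Word 3 → Word 2
  to-rotations [] = []
  to-rotations ((i , _) ∷ w) = rotation-word i ++ to-rotations w

  expand-to-rotations : ∀ w → expand (to-rotations w) ≈ w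
  expand-to-rotations [] = ~refl
  expand-to-rotations ((i , b) ∷ w) =
    ~trans (≡⇒≈ (expand-++ (rotation-word i) (to-rotations w)))
           (~cong (~trans (expand-rotation-word i) (~sym (letter b))) (expand-to-rotations w))
    where
    letter : ∀ b → (i , b) ∷ [] ≈ g i ∷ []
    letter true = ~refl
    letter false = inverse-letter i

  non-orientably-regular : NonOrientablyRegular P
  non-orientably-regular = regular , base-flag , ρᴾ , base-flag-adjacent , λ α →
    let (w , w≈α) = presentation-onto α in
    to-rotations w , λ a →
      trans (eval-expand _ (λ { (0F , true) _ → refl ; (0F , false) _ → refl ; (1F , true) _ → refl
                              ; (1F , false) _ → refl }) (to-rotations w) a)
            (trans (presentation-sound _ _ (expand-to-rotations w) a) (w≈α a))

-- The construction works for every k ≥ 1; oddness of k is only used to rule out k = 0.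
theorem5p1 : ∀ (k : ℕ) → ¬ (2 ∣ k) →
    Σ Polyhedron λ P →
    HasType P (3 * k) 4 × Tight P (3 * k) 4 × Regular P ×
    NonOrientablyRegular P × AutIsoPresentation P 3 (ΛRelators k)
theorem5p1 zero k-odd = ⊥-elim (k-odd (2 ∣0))
theorem5p1 (suc n) _ =
  P , has-type , tight , regular , non-orientably-regular ,
  (ρᴾ , presentation-sound , presentation-faithful , presentation-onto)
  where open Construction n
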